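{- Let $f:\mathfrak H^1\to\mathcal K$ be $\mathbb Q$-linear, and for $r\ge1$, $a_1,\dots,a_r\in\mathbb Z/N\mathbb Z$ let $F\binom{a_1,\dots,a_r}{x_1,\dots,x_r}=\sum_{k_1,\dots,k_r>0}f\binom{k_1,\dots,k_r}{a_1,\dots,a_r}x_1^{k_1-1}\cdots x_r^{k_r-1}\in\mathcal K[[x_1,\dots,x_r]]$ and $F^\#\binom{a_1,\dots,a_r}{x_1,\dots,x_r}=F\binom{a_1,\,a_1+a_2,\,\dots,\,a_1+\dots+a_r}{x_1,\,x_1+x_2,\,\dots,\,x_1+\dots+x_r}$. The following are equivalent: (i) for all $r,s\ge1$, all positive integers $k_1,\dots,k_{r+s}$ and all $a_1,\dots,a_{r+s}\in\mathbb Z/N\mathbb Z$, $f\binom{k_1,\dots,k_r}{a_1,\dots,a_r}f\binom{k_{r+1},\dots,k_{r+s}}{a_{r+1},\dots,a_{r+s}}=f\Big(\binom{k_1,\dots,k_r}{a_1,\dots,a_r}\mathbin{\widetilde{\sqcup\!\sqcup}}\binom{k_{r+1},\dots,k_{r+s}}{a_{r+1},\dots,a_{r+s}}\Big)$; (ii) for all $r,s\ge1$ and all $a_1,\dots,a_{r+s}\in\mathbb Z/N\mathbb Z$, $F^\#\binom{a_1,\dots,a_r}{x_1,\dots,x_r}F^\#\binom{a_{r+1},\dots,a_{r+s}}{x_{r+1},\dots,x_{r+s}}=\sum_{\sigma\in\mathrm{Sh}^{(r+s)}_r}F^\#\binom{a_{\sigma^{ -1}(1)},\dots,a_{\sigma^{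 -1}(r+s)}}{x_{\sigma^{ -1}(1)},\dots,x_{\sigma^{ -1}(r+s)}}$, where $\mathrm{Sh}^{(r+s)}_r=\{\sigma\in\mathfrak S_{r+s}:\sigma(1)<\dots<\sigma(r),\ \sigma(r+1)<\dots<\sigma(r+s)\}$ (i.e. the right side sums $F^\#$ over all shuffles of the two argument sequences, the $a$'s moving together with the $x$'s).
   Context: Fix $N\ge1$ and let $\mathcal K=\mathbb C[[q]]$. $\mathfrak H=\mathbb Q\langle x,y_a\ (a\in\mathbb Z/N\mathbb Z)\rangle$, $z_{n,a}=y_ax^{n-1}$; $\mathfrak H^1$ is the subalgebra generated under concatenation by all $z_{n,a}$ ($n\ge1$); $\binom{n_1,\dots,n_r}{a_1,\dots,a_r}=z_{n_1,a_1}\cdots z_{n_r,a_r}$. The shuffle product on $\mathfrak H$: $w\sqcup\!\sqcup1=1\sqcup\!\sqcup w=w$, $u_1w_1\sqcup\!\sqcup u_2w_2=u_1(w_1\sqcup\!\sqcup u_2w_2)+u_2(u_1w_1\sqcup\!\sqcup w_2)$ for letters $u_i$, words $w_i$. $\rho:\mathfrak H^1\to\mathfrak H^1$ is the $\mathbb Q$-linear bijection $\rho(z_{n_1,a_1}\cdots z_{n_r,a_r})=z_{n_1,a_1}z_{n_2,a_2-a_1}\cdots z_{n_r,a_r-a_{r-1}}$, and $w_1\mathbin{\widetilde{\sqcup\!\sqcup}}w_2=\rho^{ -1}(\rho(w_1)\sqcup\!\sqcup\rho(w_2))$. -}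

module Defs where

open import Level using (Level)
open import Data.Nat using (ℕ; zero; suc; _+_; _∸_; NonZero)
open import Data.Nat.Properties using (+-suc)
open import Data.Nat.DivMod using (_mod_)
open import Data.Fin using (Fin; toℕ; _↑ˡ_; _↑ʳ_) renaming (_≤?_ to _≤ᶠ?_; _≟_ to _≟ᶠ_)
open import Data.Product using (_×_; _,_; proj₁; proj₂)
open import Data.Maybe using (Maybe; just; nothing) renaming (map to mapᴹ)
open import Data.List using (List; []; _∷_; _++_; map; concatMap; filter; replicate; upTo; mapMaybe; foldr; length)
open import Data.Vec using (Vec; []; _∷_; cast; tabulate; lookup; zip; zipWith; allFin; take; drop; toList)
import Data.Vec as V
open import Data.Vec.Properties using () renaming (≡-dec to ≡-decᵛ)
import Data.Nat as Nat
open import Relation.Binary.PropositionalEquality using (_≡_; sym)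
open import Relation.Nullary using (does)
open import Data.Bool using (if_then_else_)
open import Algebra.Bundles using (CommutativeRing)

module ZMod (N : ℕ) .{{_ : NonZero N}} where

  ZN : Set
  ZN = Fin N

  0ₙ : ZN
  0ₙ = 0 mod N

  _⊕_ : ZN → ZN → ZN
  a ⊕ b = (toℕ a + toℕ b) mod N

  _⊖_ : ZN → ZN → ZN
  a ⊖ b = (toℕ a + (N ∸ toℕ b)) mod N

  -- The alphabet of 𝔥 : letters x and y_a (a ∈ Z/NZ); words of 𝔥.
  data Letter : Set where
    x : Letter
    y : ZN → Letter

  LWord : Set
  LWord = List Letter

  -- A word of 𝔥¹ : a list of letters z_{n,a}.  The pair (m , a) stands for
  -- z_{m+1,a} = y_a x^m, so the positive index n is encoded as n = suc m.
  Z : Set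
  Z = ℕ × ZN

  Word : Set
  Word = List Z

  -- A formal ℕ-linear combination of words (each list entry counted once,
  -- i.e. with multiplicity).  Shuffle products have such coefficients.
  FSum : Set → Set
  FSum = List

  toLetters : Word → LWord
  toLetters [] = []
  toLetters ((m , a) ∷ w) = y a ∷ (replicate m x ++ toLetters w)

  parseFrom : ZN → ℕ → LWord → Word
  parseFrom a m [] = (m , a) ∷ []
  parseFrom a m (x ∷ w) = parseFrom a (suc m) w
  parseFrom a m (y b ∷ w) = (m , a) ∷ parseFrom b 0 w

  parse : LWord → Maybe Word
  parse [] = just []
  parse (x ∷ _) = nothing
  parse (y a ∷ w) = just (parseFrom a 0 w)

  _ш_ : LWord → LWord → FSum LWord
  [] ш v = v ∷ []
  (u₁ ∷ w₁) ш [] = (u₁ ∷ w₁) ∷ []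
  (u₁ ∷ w₁) ш (u₂ ∷ w₂) =
    map (u₁ ∷_) (w₁ ш (u₂ ∷ w₂)) ++ map (u₂ ∷_) ((u₁ ∷ w₁) ш w₂)

  ρdiff : ZN → Word → Word
  ρdiff prev [] = []
  ρdiff prev ((m , b) ∷ w) = (m , b ⊖ prev) ∷ ρdiff b w

  ρ : Word → Word
  ρ [] = []
  ρ ((m , a) ∷ w) = (m , a) ∷ ρdiff a w

  ρinvAcc : ZN → Word → Word
  ρinvAcc acc [] = []
  ρinvAcc acc ((m , b) ∷ w) = (m , acc ⊕ b) ∷ ρinvAcc (acc ⊕ b) w

  ρ⁻¹ : Word → Word
  ρ⁻¹ = ρinvAcc 0ₙ

  _ш~_ : Word → Word → FSum Word
  w₁ ш~ w₂ = map ρ⁻¹ (mapMaybe parse (toLetters (ρ w₁) ш toLetters (ρ w₂)))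

  psumsAcc : ∀ {r} → ZN → Vec ZN r → Vec ZN r
  psumsAcc acc [] = []
  psumsAcc acc (b ∷ v) = (acc ⊕ b) ∷ psumsAcc (acc ⊕ b) v

  psums : ∀ {r} → Vec ZN r → Vec ZN r
  psums = psumsAcc 0ₙ

Mono : ℕ → Set
Mono n = Vec ℕ n

-- a polynomial with ℕ-coefficients, as a list of monomials (with multiplicity)
NPoly : ℕ → Set
NPoly n = List (Mono n)

unitMono : ∀ {n} → Fin n → Mono n
unitMono {n} j = tabulate (λ k → if does (j ≟ᶠ k) then 1 else 0)

zeroMono : ∀ {n} → Mono n
zeroMono = V.replicate _ 0

_*ᴾ_ : ∀ {n} → NPoly n → NPoly n → NPoly n
p *ᴾ q = concatMap (λ m₁ → map (λ m₂ → zipWith _+_ m₁ m₂) q) p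

_^ᴾ_ : ∀ {n} → NPoly n → ℕ → NPoly n
p ^ᴾ zero = zeroMono ∷ []
p ^ᴾ suc k = p *ᴾ (p ^ᴾ k)

yForm : ∀ {n} → Fin n → NPoly n
yForm {n} i = map unitMono (filter (λ j → j ≤ᶠ? i) (toList (allFin n)))

yMonomial : ∀ {n} → Mono n → NPoly n
yMonomial {n} m = foldr _*ᴾ_ (zeroMono ∷ []) (toList (tabulate (λ i → yForm i ^ᴾ lookup m i)))

coeffᴾ : ∀ {n} → NPoly n → Mono n → ℕ
coeffᴾ p e = length (filter (λ m → ≡-decᵛ Nat._≟_ m e) p)

comps : (n d : ℕ) → List (Mono n)
comps zero zero = [] ∷ []
comps zero (suc d) = []
comps (suc n) d = concatMap (λ k → map (k ∷_) (comps n (d ∸ k))) (upTo (suc d))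

degree : ∀ {n} → Mono n → ℕ
degree = V.foldr _ _+_ 0

-- Interleavings (shuffles) of two vectors: the list of all sequences
-- (c_{σ⁻¹(1)},…,c_{σ⁻¹(r+s)}) for σ ∈ Sh^{(r+s)}_r, c = (u₁…u_r,v₁…v_s).

interleave : ∀ {a} {A : Set a} {r s} → Vec A r → Vec A s → List (Vec A (r + s))
interleave [] v = v ∷ []
interleave (a ∷ u) [] = map (a ∷_) (interleave u [])
interleave {r = suc r} {s = suc s} (a ∷ u) (b ∷ v) =
  map (a ∷_) (interleave u (b ∷ v))
  ++ map (λ w → cast (sym (+-suc (suc r) s)) (b ∷ w)) (interleave (a ∷ u) v)

module Series {c ℓ : Level} (K : CommutativeRing c ℓ) where
  open CommutativeRing K using (Carrier; 0#; _≈_) renaming (_+_ to _+ᴷ_; _*_ to _*ᴷ_)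

  PS : ℕ → Set c
  PS n = Mono n → Carrier

  ΣL : List Carrier → Carrier
  ΣL = foldr _+ᴷ_ 0#

  _·ℕ_ : ℕ → Carrier → Carrier
  zero ·ℕ k = 0#
  suc n ·ℕ k = k +ᴷ (n ·ℕ k)

  _≈ˢ_ : ∀ {n} → PS n → PS n → Set ℓ
  G ≈ˢ H = ∀ e → G e ≈ H e

  -- G(x₁, x₁+x₂, …, x₁+⋯+x_n) : coefficient of x^e is
  --   Σ_{|m| = |e|} [x^e](Π_i y_i^{m_i}) · G_m
  -- (substitution preserves total degree, so the sum is finite)
  substPartial : ∀ {n} → PS n → PS n
  substPartial {n} G e =
    ΣL (map (λ m → coeffᴾ (yMonomial m) e ·ℕ G m) (comps n (degree e)))

  -- product of a series in x₁…x_r with a series in x_{r+1}…x_{r+s}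
  -- (disjoint variables: the coefficient of x^e is the product of the
  --  coefficients of the two parts of e)
  mulDisjoint : ∀ {r s} → PS r → PS s → PS (r + s)
  mulDisjoint {r} G H e = G (take r e) *ᴷ H (drop r e)

  -- the series G(x_{π(1)},…,x_{π(n)}) where π : Fin n → Fin n is given by
  -- the vector of its values
  permVars : ∀ {n} → PS n → Vec (Fin n) n → PS n
  permVars G π e = G (V.map (lookup e) π)

  module WithN (N : ℕ) .{{_ : NonZero N}} where
    open ZMod N

    fLin : (Word → Carrier) → FSum Word → Carrier
    fLin f ws = ΣL (map f ws)

    F : (Word → Carrier) → ∀ {r} → Vec ZN r → PS r
    F f a m = f (toList (zip m a))

    F# : (Word → Carrier) → ∀ {r} → Vec ZN r → PS r
    F# f a = substPartial (F f (psums a))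

    CondI : (Word → Carrier) → Set ℓ
    CondI f = ∀ r s (u : Vec Z (suc r)) (v : Vec Z (suc s)) →
      f (toList u) *ᴷ f (toList v) ≈ fLin f (toList u ш~ toList v)

    CondII : (Word → Carrier) → Set ℓ
    CondII f = ∀ r s (a : Vec ZN (suc r)) (b : Vec ZN (suc s)) →
      let n = suc r + suc s
          left  = zip a (V.map (_↑ˡ suc s) (allFin (suc r)))
          right = zip b (V.map (suc r ↑ʳ_) (allFin (suc s)))
      in mulDisjoint (F# f a) (F# f b)
         ≈ˢ (λ e → ΣL (map (λ w → permVars (F# f (V.map proj₁ w)) (V.map proj₂ w) e)
                            (interleave left right)))

{-# OPTIONS --safe #-}
-- Let g = f ∘ ρ⁻¹ on the words y_{a₁} x^{m₁} ⋯ y_{a_r} x^{m_r} of 𝔥¹ (G below); then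
-- F#(a; x) = Σ_m g(y_{a₁} x^{m₁} ⋯) Π_i (x₁ + ⋯ + x_i)^{m_i}, and (i) says g(u) g(v) = Σ g(u ш v).
-- Expanding the products, the coefficient of x^e in F#(a) is the sum of g over a multiset of words:
-- write the word letter by letter, letting every x pick one of the variables activated by the y's
-- before it.  A shuffle of two such words is the same thing as such a word for an interleaving of the
-- two letter sequences, so the coefficient of x^e in the right-hand side of (ii) is the sum of g over
-- all shuffles of pairs of words from the two factors; this gives (i) ⇒ (ii).  Conversely (ii) says
-- that g(u) g(v) − Σ g(u ш v), summed over the pairs of words of any two expansions, vanishes.  In
-- the expansion for the exponent vector m the word y_{a₁} x^{m₁} ⋯ occurs once and all other words
-- have fewer pairs "x before y", so induction on that number isolates each pair of words.
module Submission where

open import Defs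
open import Data.Nat using (ℕ; NonZero)
open import Algebra.Bundles using (CommutativeRing)
open import Function.Bundles using (_⇔_; mk⇔)
open import Level using (Level)

module ListProperties where

  open import Data.Bool using (true; false)
  open import Data.List using (List; []; _∷_; _++_; map; concatMap; filter)
  import Data.List.Properties as LP
  open import Data.List.Membership.Propositional using (_∈_)
  open import Data.List.Relation.Unary.All using (All; []; _∷_)
  open import Data.List.Relation.Unary.Any using (here; there)
  open import Data.List.Relation.Binary.Permutation.Propositional
  open import Data.List.Relation.Binary.Permutation.Propositional.Properties
    using (++⁺; ++⁺ˡ; ++⁺ʳ; shifts; ++-comm)
    renaming (++-assoc to ↭-++-assoc)
  open import Relation.Binary.PropositionalEquality using (_≡_; refl; sym; cong) renaming (trans to ≡-trans)
  open import Relation.Nullary using (does)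
  open import Relation.Unary using (Pred; Decidable)
  open import Data.Product using (_×_; proj₁; proj₂)
  open import Data.Vec as V using (Vec; []; _∷_; toList; zip)
  import Data.Vec.Properties as VP

  module _ {A B : Set} where
    concatMap-cong-↭ : ∀ {f g : A → List B} (xs : List A) → (∀ x → f x ↭ g x) →
              concatMap f xs ↭ concatMap g xs
    concatMap-cong-↭ [] p = ↭-refl
    concatMap-cong-↭ (x ∷ xs) p = ++⁺ (p x) (concatMap-cong-↭ xs p)

    concatMap-cong-↭-∈ : ∀ {f g : A → List B} (xs : List A) → (∀ x → x ∈ xs → f x ↭ g x) →
              concatMap f xs ↭ concatMap g xs
    concatMap-cong-↭-∈ [] p = ↭-refl
    concatMap-cong-↭-∈ (x ∷ xs) p = ++⁺ (p x (here refl)) (concatMap-cong-↭-∈ xs (λ z z∈ → p z (there z∈)))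

    concatMap-[]-∈ : ∀ (f : A → List B) (xs : List A) → (∀ x → x ∈ xs → f x ≡ []) → concatMap f xs ≡ []
    concatMap-[]-∈ f [] p = refl
    concatMap-[]-∈ f (x ∷ xs) p rewrite p x (here refl) = concatMap-[]-∈ f xs (λ z z∈ → p z (there z∈))

    concatMap-pointwise-++ : ∀ (f g : A → List B) (xs : List A) →
            concatMap (λ x → f x ++ g x) xs ↭ concatMap f xs ++ concatMap g xs
    concatMap-pointwise-++ f g [] = ↭-refl
    concatMap-pointwise-++ f g (x ∷ xs) =
      ↭-trans (↭-++-assoc (f x) (g x) _)
      (↭-trans (++⁺ˡ (f x) (++⁺ˡ (g x) (concatMap-pointwise-++ f g xs)))
      (↭-trans (++⁺ˡ (f x) (shifts (g x) (concatMap f xs)))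
      (↭-sym (↭-++-assoc (f x) (concatMap f xs) _))))

    concatMap-resp-↭ : ∀ (f : A → List B) {xs ys : List A} → xs ↭ ys → concatMap f xs ↭ concatMap f ys
    concatMap-resp-↭ f refl = ↭-refl
    concatMap-resp-↭ f (prep x p) = ++⁺ˡ (f x) (concatMap-resp-↭ f p)
    concatMap-resp-↭ f (swap x y p) =
      ↭-trans (↭-sym (↭-++-assoc (f x) (f y) _))
      (↭-trans (++⁺ʳ _ (++-comm (f x) (f y)))
      (↭-trans (↭-++-assoc (f y) (f x) _)
        (++⁺ˡ (f y) (++⁺ˡ (f x) (concatMap-resp-↭ f p)))))
    concatMap-resp-↭ f (trans p q) = ↭-trans (concatMap-resp-↭ f p) (concatMap-resp-↭ f q)

    concatMap-[] : ∀ (f : A → List B) (xs : List A) → (∀ x → f x ≡ []) → concatMap f xs ≡ []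
    concatMap-[] f xs p = concatMap-[]-∈ f xs (λ x _ → p x)

  module _ {A B C : Set} where
    concatMap-comm : ∀ (f : A → B → List C) (xs : List A) (ys : List B) →
      concatMap (λ x → concatMap (λ y → f x y) ys) xs ↭
      concatMap (λ y → concatMap (λ x → f x y) xs) ys
    concatMap-comm f [] ys = ↭-reflexive (sym (concatMap-[] (λ y → []) ys (λ _ → refl)))
    concatMap-comm f (x ∷ xs) ys =
      ↭-trans (++⁺ˡ (concatMap (f x) ys) (concatMap-comm f xs ys))
        (↭-sym (concatMap-pointwise-++ (f x) (λ y → concatMap (λ x' → f x' y) xs) ys))

    concatMap-concatMap : ∀ (g : B → List C) (h : A → List B) (xs : List A) →
      concatMap g (concatMap h xs) ≡ concatMap (λ x → concatMap g (h x)) xs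
    concatMap-concatMap g h [] = refl
    concatMap-concatMap g h (x ∷ xs) = ≡-trans (LP.concatMap-++ g (h x) (concatMap h xs)) (cong (concatMap g (h x) ++_) (concatMap-concatMap g h xs))

  filter-map-comm : ∀ {A B : Set} {p q} {P : Pred B p} {Q : Pred A q} (P? : Decidable P) (Q? : Decidable Q)
    (g : A → B) {xs : List A} → All (λ x → does (P? (g x)) ≡ does (Q? x)) xs → filter P? (map g xs) ≡ map g (filter Q? xs)
  filter-map-comm P? Q? g [] = refl
  filter-map-comm P? Q? g {x ∷ xs} (h ∷ hs) with does (P? (g x)) | does (Q? x) | h
  ... | true | true | _ = cong (g x ∷_) (filter-map-comm P? Q? g hs)
  ... | false | false | _ = filter-map-comm P? Q? g hs

  map-proj₂-toList-zip : ∀ {A B : Set} {n} (a : Vec A n) (v : Vec B n) → map proj₂ (toList (zip a v)) ≡ toList v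
  map-proj₂-toList-zip a v = ≡-trans (sym (VP.toList-map proj₂ (zip a v))) (cong toList (VP.map-proj₂-zip a v))

  zip-map-proj : ∀ {A B : Set} {n} (w : Vec (A × B) n) → zip (V.map proj₁ w) (V.map proj₂ w) ≡ w
  zip-map-proj [] = refl
  zip-map-proj (p ∷ w) = cong (p ∷_) (zip-map-proj w)

  take-++ : ∀ {A : Set} {m n} (xs : Vec A m) (ys : Vec A n) → V.take m (xs V.++ ys) ≡ xs
  take-++ [] ys = refl
  take-++ (z ∷ xs) ys = cong (z ∷_) (take-++ xs ys)

  drop-++ : ∀ {A : Set} {m n} (xs : Vec A m) (ys : Vec A n) → V.drop m (xs V.++ ys) ≡ ys
  drop-++ [] ys = refl
  drop-++ (z ∷ xs) ys = drop-++ xs ys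


module SumOver where

  open import Data.Nat using (ℕ; suc; _+_; _≤_; z≤n; s≤s)
  open import Data.Nat.ListAction using (sum)
  open import Data.Nat.ListAction.Properties using (sum-++; sum-↭)
  open import Data.Nat.Properties
  open import Data.Fin using (Fin) renaming (_≟_ to _≟ᶠ_)
  open import Data.List using (List; []; _∷_; _++_; map)
  import Data.List.Properties as LP
  open import Data.List.Membership.Propositional using (_∈_; _∉_)
  open import Data.List.Relation.Unary.Any using (here; there)
  open import Data.List.Relation.Binary.Permutation.Propositional using (_↭_)
  import Data.List.Relation.Binary.Permutation.Propositional.Properties as PP
  open import Data.Vec as V using (Vec; []; _∷_; lookup; _[_]≔_; toList; allFin)
  open import Data.Vec.Properties using (lookup∘update; lookup∘update′; map-lookup-allFin)
  open import Relation.Binary.PropositionalEquality using (_≡_; refl; sym; cong; cong₂; trans; subst)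
  open import Relation.Nullary using (yes; no)
  open import Data.List.Relation.Unary.All using (All; []; _∷_)

  finList : ∀ n → List (Fin n)
  finList n = toList (allFin n)

  sumOver : ∀ {n} → List (Fin n) → Vec ℕ n → ℕ
  sumOver S e = sum (map (lookup e) S)

  sumOver-++ : ∀ {n} (S T : List (Fin n)) e → sumOver (S ++ T) e ≡ sumOver S e + sumOver T e
  sumOver-++ S T e = trans (cong sum (LP.map-++ (lookup e) S T)) (sum-++ (map (lookup e) S) _)

  sumOver-↭ : ∀ {n} {S S' : List (Fin n)} e → S ↭ S' → sumOver S e ≡ sumOver S' e
  sumOver-↭ e p = sum-↭ (PP.map⁺ (lookup e) p)

  sumOver-map : ∀ {m n} (f : Fin m → Fin n) (S : List (Fin m)) e e' →
                (∀ l → lookup e' (f l) ≡ lookup e l) → sumOver (map f S) e' ≡ sumOver S e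
  sumOver-map f S e e' h = cong sum (trans (sym (LP.map-∘ S)) (LP.map-cong h S))

  sumOver-cong : ∀ {n} (S : List (Fin n)) e e' → (∀ l → l ∈ S → lookup e l ≡ lookup e' l) →
                 sumOver S e ≡ sumOver S e'
  sumOver-cong [] e e' h = refl
  sumOver-cong (l ∷ S) e e' h = cong₂ _+_ (h l (here refl)) (sumOver-cong S e e' (λ j j∈ → h j (there j∈)))

  degree-map-lookup : ∀ {n k} (e : Vec ℕ n) (π : Vec (Fin n) k) → degree (V.map (lookup e) π) ≡ sumOver (toList π) e
  degree-map-lookup e [] = refl
  degree-map-lookup e (l ∷ π) = cong (lookup e l +_) (degree-map-lookup e π)

  sumOver-finList : ∀ {n} (e : Vec ℕ n) → sumOver (finList n) e ≡ degree e
  sumOver-finList {n} e = trans (sym (degree-map-lookup e (allFin n))) (cong degree (map-lookup-allFin e))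

  module _ {n : ℕ} where
    lookup-decrement-≤ : ∀ (e : Vec ℕ n) l k j → lookup e l ≡ suc k → lookup (e [ l ]≔ k) j ≤ lookup e j
    lookup-decrement-≤ e l k j eq with j ≟ᶠ l
    ... | yes refl rewrite lookup∘update j e k | eq = n≤1+n k
    ... | no j≢l rewrite lookup∘update′ j≢l e k = ≤-refl

    sumOver-decrement-≤ : ∀ S (e : Vec ℕ n) l k → lookup e l ≡ suc k → sumOver S (e [ l ]≔ k) ≤ sumOver S e
    sumOver-decrement-≤ [] e l k eq = z≤n
    sumOver-decrement-≤ (j ∷ S) e l k eq = +-mono-≤ (lookup-decrement-≤ e l k j eq) (sumOver-decrement-≤ S e l k eq)

    sumOver-decrement-< : ∀ S (e : Vec ℕ n) l k → l ∈ S → lookup e l ≡ suc k → suc (sumOver S (e [ l ]≔ k)) ≤ sumOver S e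
    sumOver-decrement-< (j ∷ S) e l k (here refl) eq rewrite lookup∘update l e k | eq =
      s≤s (+-monoʳ-≤ k (sumOver-decrement-≤ S e l k eq))
    sumOver-decrement-< (j ∷ S) e l k (there p) eq =
      subst (_≤ lookup e j + sumOver S e) (+-suc (lookup (e [ l ]≔ k) j) _)
        (+-mono-≤ (lookup-decrement-≤ e l k j eq) (sumOver-decrement-< S e l k p eq))

    lookup≤sumOver : ∀ S (e : Vec ℕ n) l → l ∈ S → lookup e l ≤ sumOver S e
    lookup≤sumOver (j ∷ S) e l (here refl) = m≤m+n _ _
    lookup≤sumOver (j ∷ S) e l (there p) = ≤-trans (lookup≤sumOver S e l p) (m≤n+m _ _)

    sumOver-update : ∀ (S : List (Fin n)) e l k → l ∉ S → sumOver S (e [ l ]≔ k) ≡ sumOver S e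
    sumOver-update S e l k l∉S = sumOver-cong S (e [ l ]≔ k) e (λ j j∈ → lookup∘update′ (λ j≡l → l∉S (subst (_∈ S) j≡l j∈)) e k)

    sumOver-zero : ∀ (e : Vec ℕ n) (S : List (Fin n)) → All (λ l → lookup e l ≡ 0) S → sumOver S e ≡ 0
    sumOver-zero e [] [] = refl
    sumOver-zero e (l ∷ S) (h ∷ hs) rewrite h = sumOver-zero e S hs


module Monomials where

  open import Data.Nat using (ℕ; zero; suc; _+_; _≟_)
  open import Data.Nat.Properties using (suc-injective; +-assoc; +-suc)
  open import Data.Fin using (Fin) renaming (zero to fzero; suc to fsuc; _≟_ to _≟ᶠ_)
  open import Data.Bool using (true; false; if_then_else_)
  open import Data.List using (List; []; _∷_; _++_; map; concatMap; filter; length; foldr)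
  import Data.List.Properties as LP
  open import Data.Vec using (Vec; []; _∷_; lookup; _[_]≔_; zipWith)
  open import Data.Vec.Properties
    using (lookup∘update; lookup∘update′; lookup-zipWith; lookup∘tabulate; zipWith-assoc;
           zipWith-identityˡ; tabulate∘lookup; tabulate-cong)
    renaming (≡-dec to ≡-decᵛ)
  open import Relation.Binary.PropositionalEquality using (_≡_; _≢_; refl; sym; cong; trans)
  open import Relation.Nullary using (yes; no; does)
  open import Relation.Nullary.Decidable using (dec-false; does-⇔)
  open import Relation.Unary using (Pred; Decidable)
  open import Function.Bundles using (mk⇔)
  open ListProperties using (concatMap-concatMap)

  module _ {A : Set} {p} {P : Pred A p} (P? : Decidable P) where
    length-filter-map : ∀ {B : Set} (g : B → A) (xs : List B) →
      length (filter P? (map g xs)) ≡ length (filter (λ x → P? (g x)) xs)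
    length-filter-map g [] = refl
    length-filter-map g (x ∷ xs) with does (P? (g x))
    ... | true = cong suc (length-filter-map g xs)
    ... | false = length-filter-map g xs

    length-filter-cong : ∀ {q} {Q : Pred A q} (Q? : Decidable Q) (xs : List A) →
      (∀ x → does (P? x) ≡ does (Q? x)) → length (filter P? xs) ≡ length (filter Q? xs)
    length-filter-cong Q? [] h = refl
    length-filter-cong Q? (x ∷ xs) h with does (P? x) | does (Q? x) | h x
    ... | true | true | _ = cong suc (length-filter-cong Q? xs h)
    ... | false | false | _ = length-filter-cong Q? xs h

    length-filter-none : ∀ (xs : List A) → (∀ x → does (P? x) ≡ false) → length (filter P? xs) ≡ 0
    length-filter-none [] h = refl
    length-filter-none (x ∷ xs) h with does (P? x) | h x
    ... | false | _ = length-filter-none xs h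

  lookup-ext : ∀ {A : Set} {n} (u v : Vec A n) → (∀ i → lookup u i ≡ lookup v i) → u ≡ v
  lookup-ext u v h = trans (sym (tabulate∘lookup u)) (trans (tabulate-cong h) (tabulate∘lookup v))

  degree≡0⇒zeroMono : ∀ {n} (e : Mono n) → degree e ≡ 0 → e ≡ zeroMono
  degree≡0⇒zeroMono [] h = refl
  degree≡0⇒zeroMono (zero ∷ e) h = cong (0 ∷_) (degree≡0⇒zeroMono e h)

  module _ {n : ℕ} where
    coeffᴾ-++ : ∀ (p q : NPoly n) e → coeffᴾ (p ++ q) e ≡ coeffᴾ p e + coeffᴾ q e
    coeffᴾ-++ p q e = trans (cong length (LP.filter-++ _ p q)) (LP.length-++ (filter _ p))

    coeffᴾ-concatMap : ∀ {A : Set} (g : A → NPoly n) (xs : List A) e →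
      coeffᴾ (concatMap g xs) e ≡ foldr _+_ 0 (map (λ x → coeffᴾ (g x) e) xs)
    coeffᴾ-concatMap g [] e = refl
    coeffᴾ-concatMap g (x ∷ xs) e =
      trans (coeffᴾ-++ (g x) (concatMap g xs) e) (cong (coeffᴾ (g x) e +_) (coeffᴾ-concatMap g xs e))

    lookup-unitMono-+ : ∀ (l j : Fin n) q →
      lookup (zipWith _+_ (unitMono l) q) j ≡ (if does (l ≟ᶠ j) then 1 else 0) + lookup q j
    lookup-unitMono-+ l j q = trans (lookup-zipWith _+_ j (unitMono l) q) (cong (_+ lookup q j) (lookup∘tabulate _ j))

    unitMono-+-≢ : ∀ l q (e : Mono n) → lookup e l ≡ 0 → zipWith _+_ (unitMono l) q ≢ e
    unitMono-+-≢ l q e e[l]≡0 eq with l ≟ᶠ l | lookup-unitMono-+ l l q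
    ... | yes _ | g with () ← trans (sym e[l]≡0) (trans (cong (λ v → lookup v l) (sym eq)) g)
    ... | no l≢l | _ with () ← l≢l refl

    unitMono-+-≡ : ∀ l q (e : Mono n) k → lookup e l ≡ suc k →
      zipWith _+_ (unitMono l) q ≡ e → q ≡ e [ l ]≔ k
    unitMono-+-≡ l q e k e[l]≡1+k eq = lookup-ext q _ pointwise
      where
        pointwise : ∀ j → lookup q j ≡ lookup (e [ l ]≔ k) j
        pointwise j with l ≟ᶠ j | lookup-unitMono-+ l j q
        ... | yes refl | g rewrite lookup∘update l e k =
              suc-injective (trans (sym g) (trans (cong (λ v → lookup v l) eq) e[l]≡1+k))
        ... | no l≢j | g rewrite lookup∘update′ (λ j≡l → l≢j (sym j≡l)) e k =
              trans (sym g) (cong (λ v → lookup v j) eq)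

    unitMono-+-update : ∀ l (e : Mono n) k → lookup e l ≡ suc k → zipWith _+_ (unitMono l) (e [ l ]≔ k) ≡ e
    unitMono-+-update l e k e[l]≡1+k = lookup-ext _ e pointwise
      where
        pointwise : ∀ j → lookup (zipWith _+_ (unitMono l) (e [ l ]≔ k)) j ≡ lookup e j
        pointwise j with l ≟ᶠ j | lookup-unitMono-+ l j (e [ l ]≔ k)
        ... | yes refl | g rewrite lookup∘update l e k = trans g (sym e[l]≡1+k)
        ... | no l≢j | g rewrite lookup∘update′ (λ j≡l → l≢j (sym j≡l)) e k = g

    -- [x^e] (x_l · Q), read off from the exponent of x_l in e
    coeffᴾ-lowered : Mono n → Fin n → ℕ → NPoly n → ℕ
    coeffᴾ-lowered e l zero Q = 0
    coeffᴾ-lowered e l (suc k) Q = coeffᴾ Q (e [ l ]≔ k)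

    coeffᴾ-shift-unitMono : ∀ (e : Mono n) l (Q : NPoly n) →
      coeffᴾ (map (zipWith _+_ (unitMono l)) Q) e ≡ coeffᴾ-lowered e l (lookup e l) Q
    coeffᴾ-shift-unitMono e l Q = trans (length-filter-map _ (zipWith _+_ (unitMono l)) Q) (byExponent (lookup e l) refl)
      where
        byExponent : ∀ k → lookup e l ≡ k →
          length (filter (λ q → ≡-decᵛ _≟_ (zipWith _+_ (unitMono l) q) e) Q) ≡ coeffᴾ-lowered e l k Q
        byExponent zero eq = length-filter-none _ Q (λ q → dec-false (≡-decᵛ _≟_ _ e) (unitMono-+-≢ l q e eq))
        byExponent (suc k) eq = length-filter-cong _ _ Q (λ q →
          does-⇔ (mk⇔ (unitMono-+-≡ l q e k eq) (λ { refl → unitMono-+-update l e k eq }))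
                 (≡-decᵛ _≟_ _ e) (≡-decᵛ _≟_ q (e [ l ]≔ k)))

    *ᴾ-identityˡ : ∀ (Q : NPoly n) → (zeroMono ∷ []) *ᴾ Q ≡ Q
    *ᴾ-identityˡ Q = trans (LP.++-identityʳ _) (trans (LP.map-cong (zipWith-identityˡ (λ _ → refl)) Q) (LP.map-id Q))

    *ᴾ-assoc : ∀ (A B C : NPoly n) → (A *ᴾ B) *ᴾ C ≡ A *ᴾ (B *ᴾ C)
    *ᴾ-assoc A B C =
      trans (concatMap-concatMap (λ ab → map (zipWith _+_ ab) C) (λ a → map (zipWith _+_ a) B) A)
      (trans (LP.concatMap-cong (λ a → LP.concatMap-map (λ ab → map (zipWith _+_ ab) C) (zipWith _+_ a) B) A)
      (LP.concatMap-cong (λ a → trans (LP.concatMap-cong (λ b →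
          trans (LP.map-cong (λ c → zipWith-assoc +-assoc a b c) C) (LP.map-∘ C)) B)
        (sym (LP.map-concatMap (zipWith _+_ a) (λ b → map (zipWith _+_ b) C) B))) A))

    coeffᴾ-one : ∀ (e : Mono n) → degree e ≡ 0 → coeffᴾ (zeroMono ∷ []) e ≡ 1
    coeffᴾ-one e h rewrite degree≡0⇒zeroMono e h with ≡-decᵛ _≟_ (zeroMono {n}) zeroMono
    ... | yes _ = refl
    ... | no ¬p with () ← ¬p refl

  degree-decrement : ∀ {n} (e : Mono n) l k → lookup e l ≡ suc k → suc (degree (e [ l ]≔ k)) ≡ degree e
  degree-decrement (a ∷ e) fzero k refl = refl
  degree-decrement (a ∷ e) (fsuc l) k eq = trans (sym (+-suc a _)) (cong (a +_) (degree-decrement e l k eq))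


module PartialSums where

  open import Data.Nat using (ℕ; suc; s≤s)
  import Data.Nat.Properties as NP
  open import Data.Fin using (Fin; zero) renaming (suc to fsuc; _≤?_ to _≤ᶠ?_)
  open import Data.List using (List; []; _∷_; _++_; map; filter)
  import Data.List.Properties as LP
  import Data.List.Relation.Unary.All as All
  open import Data.Vec using (Vec; []; _∷_; lookup; tabulate; toList; allFin)
  import Data.Vec.Properties as VP
  open import Relation.Nullary.Decidable using (does-⇔)
  open import Relation.Binary.PropositionalEquality using (_≡_; refl; sym; trans; cong; cong₂)
  open import Function.Bundles using (mk⇔)
  open ListProperties using (filter-map-comm)
  open SumOver using (finList)

  partialSumPowers : ∀ {n} → List (Fin n) → List (Fin n) → List ℕ → List (NPoly n)
  partialSumPowers S (l ∷ ls) (m ∷ ms) = (map unitMono (S ++ l ∷ [])) ^ᴾ m ∷ partialSumPowers (S ++ l ∷ []) ls ms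
  partialSumPowers S _ _ = []

  toList-tabulate-suc : ∀ k → toList (tabulate {k} fsuc) ≡ map fsuc (finList k)
  toList-tabulate-suc k = trans (cong toList (VP.tabulate-∘ fsuc (λ i → i))) (VP.toList-map fsuc (allFin k))

  filter-≤zero-suc : ∀ {k} (L : List (Fin k)) → filter (λ j → j ≤ᶠ? (zero {k})) (map fsuc L) ≡ []
  filter-≤zero-suc [] = refl
  filter-≤zero-suc (x ∷ L) = filter-≤zero-suc L

  filter-≤suc-suc : ∀ {k} (i : Fin k) (L : List (Fin k)) →
    filter (λ j → j ≤ᶠ? fsuc i) (map fsuc L) ≡ map fsuc (filter (λ j → j ≤ᶠ? i) L)
  filter-≤suc-suc i L =
    filter-map-comm _ _ fsuc (All.universal (λ x → does-⇔ (mk⇔ NP.≤-pred s≤s) (fsuc x ≤ᶠ? fsuc i) (x ≤ᶠ? i)) L)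

  partialSumPowers-tabulate : ∀ {n k} (S : List (Fin n)) (ι : Fin k → Fin n) (m : Vec ℕ k) →
    toList (tabulate (λ i → map unitMono (S ++ map ι (filter (λ j → j ≤ᶠ? i) (finList k))) ^ᴾ lookup m i))
    ≡ partialSumPowers S (map ι (finList k)) (toList m)
  partialSumPowers-tabulate {k = 0} S ι [] = refl
  partialSumPowers-tabulate {k = suc k} S ι (m₀ ∷ m) =
    cong₂ _∷_ (cong (λ z → map unitMono (S ++ ι zero ∷ map ι z) ^ᴾ m₀) first-prefix)
      (trans (cong toList (VP.tabulate-cong (λ i → cong (λ z → map unitMono z ^ᴾ lookup m i) (later-prefix i))))
      (trans (partialSumPowers-tabulate (S ++ ι zero ∷ []) (λ j → ι (fsuc j)) m)
             (cong (λ z → partialSumPowers (S ++ ι zero ∷ []) z (toList m))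
                   (trans (LP.map-∘ (finList k)) (cong (map ι) (sym (toList-tabulate-suc k)))))))
    where
      first-prefix : filter (λ j → j ≤ᶠ? zero {k}) (toList (tabulate {k} fsuc)) ≡ []
      first-prefix = trans (cong (filter _) (toList-tabulate-suc k)) (filter-≤zero-suc (finList k))

      later-prefix : ∀ i → S ++ map ι (zero ∷ filter (λ j → j ≤ᶠ? fsuc i) (toList (tabulate {k} fsuc)))
                         ≡ (S ++ ι zero ∷ []) ++ map (λ j → ι (fsuc j)) (filter (λ j → j ≤ᶠ? i) (finList k))
      later-prefix i =
        trans (cong (λ z → S ++ ι zero ∷ map ι z)
                    (trans (cong (filter _) (toList-tabulate-suc k)) (filter-≤suc-suc i (finList k))))
        (trans (cong (λ z → S ++ ι zero ∷ z) (sym (LP.map-∘ (filter (λ j → j ≤ᶠ? i) (finList k)))))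
               (sym (LP.++-assoc S (ι zero ∷ []) _)))

  yForm-powers : ∀ {n} (m : Vec ℕ n) →
    toList (tabulate (λ i → yForm i ^ᴾ lookup m i)) ≡ partialSumPowers [] (finList n) (toList m)
  yForm-powers {n} m =
    trans (cong toList (VP.tabulate-cong (λ i → cong (λ z → map unitMono z ^ᴾ lookup m i) (sym (LP.map-id _)))))
    (trans (partialSumPowers-tabulate [] (λ j → j) m)
           (cong (λ z → partialSumPowers [] z (toList m)) (LP.map-id (finList n))))


module Expansion (N : ℕ) .{{_ : NonZero N}} where

  open ZMod N
  open ListProperties
  open import Data.Nat using (ℕ; zero; suc)
  open import Data.Fin using (Fin)
  open import Data.Product using (_×_; _,_)
  open import Data.List using (List; []; _∷_; _++_; map; concatMap; replicate)
  import Data.List.Properties as LP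
  open import Data.List.Membership.Propositional using (_∈_)
  open import Data.List.Relation.Binary.Permutation.Propositional
  open import Data.List.Relation.Binary.Permutation.Propositional.Properties using (++⁺; ++⁺ʳ; map⁺)
  open import Data.Vec using (Vec; lookup; _[_]≔_; toList; zip; allFin)
  open import Relation.Binary.PropositionalEquality using (_≡_; refl)

  -- The letters y_a still to be written, each paired with the variable x_l it activates.
  Letters : ℕ → Set
  Letters n = List (ZN × Fin n)

  lettersOf : ∀ {n} → Vec ZN n → Letters n
  lettersOf {n} a = toList (zip a (allFin n))

  wordOf : ∀ {n} → Letters n → List ℕ → LWord
  wordOf ((a , l) ∷ c) (k ∷ ks) = y a ∷ (replicate k x ++ wordOf c ks)
  wordOf _ _ = []

  endStep : ∀ {n} → Letters n → ℕ → List LWord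
  endStep [] zero = [] ∷ []
  endStep [] (suc _) = []
  endStep (_ ∷ _) _ = []

  -- expansion S c d e lists the words x^j y_{a₁} x^{k₁} y_{a₂} x^{k₂} ⋯ (c = (a₁ , l₁) ∷ ⋯), each as
  -- often as x^e occurs in the expansion of (Σ S)^j Π_i (Σ S + x_{l₁} + ⋯ + x_{l_i})^{k_i}: the word is
  -- written letter by letter, every x picking one of the active variables S and every y activating its
  -- variable.  d counts the x's still to be written (the degree of e in every use).
  mutual
    expansion : ∀ {n} → List (Fin n) → Letters n → ℕ → Vec ℕ n → List LWord
    expansion S c d e = expansionˣ S c d e ++ expansionʸ S c d e ++ endStep c d

    expansionˣ : ∀ {n} → List (Fin n) → Letters n → ℕ → Vec ℕ n → List LWord
    expansionˣ S c zero e = []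
    expansionˣ S c (suc d) e = concatMap (λ l → expansionˣ-at S c d e l (lookup e l)) S

    expansionˣ-at : ∀ {n} → List (Fin n) → Letters n → ℕ → Vec ℕ n → Fin n → ℕ → List LWord
    expansionˣ-at S c d e l zero = []
    expansionˣ-at S c d e l (suc k) = map (x ∷_) (expansion S c d (e [ l ]≔ k))

    expansionʸ : ∀ {n} → List (Fin n) → Letters n → ℕ → Vec ℕ n → List LWord
    expansionʸ S [] d e = []
    expansionʸ S ((a , l) ∷ c) d e = map (y a ∷_) (expansion (S ++ l ∷ []) c d e)

  module _ {n : ℕ} where
    Expander : Set
    Expander = List (Fin n) → Letters n → ℕ → Vec ℕ n → List LWord

    xStepAt : Expander → List (Fin n) → Letters n → ℕ → Vec ℕ n → Fin n → ℕ → List LWord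
    xStepAt F S c d e l zero = []
    xStepAt F S c d e l (suc k) = map (x ∷_) (F S c d (e [ l ]≔ k))

    xStep : Expander → Expander
    xStep F S c zero e = []
    xStep F S c (suc d) e = concatMap (λ l → xStepAt F S c d e l (lookup e l)) S

    yStep : Expander → Expander
    yStep F S [] d e = []
    yStep F S ((a , l) ∷ c) d e = map (y a ∷_) (F (S ++ l ∷ []) c d e)

    expansionˣ-xStep : ∀ S c d e → expansionˣ S c d e ≡ xStep expansion S c d e
    expansionˣ-xStep S c zero e = refl
    expansionˣ-xStep S c (suc d) e = LP.concatMap-cong (λ l → atExponent l (lookup e l)) S
      where atExponent : ∀ l k → expansionˣ-at S c d e l k ≡ xStepAt expansion S c d e l k
            atExponent l zero = refl
            atExponent l (suc k) = refl

    expansionʸ-yStep : ∀ S c d e → expansionʸ S c d e ≡ yStep expansion S c d e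
    expansionʸ-yStep S [] d e = refl
    expansionʸ-yStep S ((a , l) ∷ c) d e = refl

    expansion-unfold : ∀ S c d e →
      expansion S c d e ≡ xStep expansion S c d e ++ yStep expansion S c d e ++ endStep c d
    expansion-unfold S c d e rewrite expansionˣ-xStep S c d e | expansionʸ-yStep S c d e = refl

    xStepAt-cong : ∀ (F G : Expander) S c d e l k →
      (∀ k' → k ≡ suc k' → F S c d (e [ l ]≔ k') ↭ G S c d (e [ l ]≔ k')) →
      xStepAt F S c d e l k ↭ xStepAt G S c d e l k
    xStepAt-cong F G S c d e l zero h = ↭-refl
    xStepAt-cong F G S c d e l (suc k) h = map⁺ (x ∷_) (h k refl)

    xStep-cong : ∀ (F G : Expander) S c d e →
      (∀ d' l k → d ≡ suc d' → l ∈ S → lookup e l ≡ suc k → F S c d' (e [ l ]≔ k) ↭ G S c d' (e [ l ]≔ k)) →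
      xStep F S c d e ↭ xStep G S c d e
    xStep-cong F G S c zero e h = ↭-refl
    xStep-cong F G S c (suc d) e h =
      concatMap-cong-↭-∈ S (λ l l∈ → xStepAt-cong F G S c d e l (lookup e l) (λ k' eq → h d l k' refl l∈ eq))

    yStep-cong : ∀ (F G : Expander) S c d e →
      (∀ a l c' → c ≡ (a , l) ∷ c' → F (S ++ l ∷ []) c' d e ↭ G (S ++ l ∷ []) c' d e) →
      yStep F S c d e ↭ yStep G S c d e
    yStep-cong F G S [] d e h = ↭-refl
    yStep-cong F G S ((a , l) ∷ c) d e h = map⁺ (y a ∷_) (h a l c refl)

    expansion-resp-↭ : ∀ {S S'} (c : Letters n) d e → S ↭ S' → expansion S c d e ↭ expansion S' c d e
    expansion-resp-↭ {S} {S'} c d e p =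
      ↭-trans (↭-reflexive (expansion-unfold S c d e))
      (↭-trans (++⁺ (xPart d e) (++⁺ (yPart c) ↭-refl))
      (↭-sym (↭-reflexive (expansion-unfold S' c d e))))
      where
        xPart : ∀ d e → xStep expansion S c d e ↭ xStep expansion S' c d e
        xPart zero e = ↭-refl
        xPart (suc d) e =
          ↭-trans (concatMap-resp-↭ (λ l → xStepAt expansion S c d e l (lookup e l)) p)
            (concatMap-cong-↭ S' (λ l → atExponent l (lookup e l)))
          where atExponent : ∀ l k → xStepAt expansion S c d e l k ↭ xStepAt expansion S' c d e l k
                atExponent l zero = ↭-refl
                atExponent l (suc k) = map⁺ (x ∷_) (expansion-resp-↭ c d (e [ l ]≔ k) p)
        yPart : ∀ c → yStep expansion S c d e ↭ yStep expansion S' c d e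
        yPart [] = ↭-refl
        yPart ((a , l) ∷ c) = map⁺ (y a ∷_) (expansion-resp-↭ c d e (++⁺ʳ (l ∷ []) p))


module ShuffleOfExpansions (N : ℕ) .{{_ : NonZero N}} where

  open ZMod N
  open ListProperties
  open SumOver
  open Expansion N
  open import Data.Nat using (ℕ; zero; suc; _+_; _≤_; _<_; s≤s)
  open import Data.Nat.Properties
  open import Data.Fin using (Fin; _↑ˡ_; _↑ʳ_)
  open import Data.Product using (_×_; _,_; proj₂)
  open import Data.List using (List; []; _∷_; _++_; map; concatMap; length)
  import Data.List.Properties as LP
  open import Data.List.Membership.Propositional using (_∈_)
  open import Data.List.Relation.Binary.Permutation.Propositional using (_↭_; ↭-refl; ↭-sym; ↭-trans; ↭-reflexive)
  open import Data.List.Relation.Binary.Permutation.Propositional.Properties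
    using (++⁺; ++⁺ˡ; shifts; ++-comm; map⁺)
    renaming (++-assoc to ↭-++-assoc; ++-identityʳ to ↭-++-identityʳ)
  open import Data.Vec using (Vec; lookup; _[_]≔_) renaming (_++_ to _++ᵛ_)
  open import Data.Vec.Properties using (lookup-++ˡ; lookup-++ʳ; []≔-++-↑ˡ; []≔-++-↑ʳ)
  open import Relation.Binary.PropositionalEquality using (_≡_; refl; sym; trans; cong; cong₂; subst)

  shuffleAll : List LWord → List LWord → List LWord
  shuffleAll A B = concatMap (λ u → concatMap (λ v → u ш v) B) A

  shuffleˡ : LWord → LWord → List LWord
  shuffleˡ [] v = []
  shuffleˡ (p ∷ u) v = map (p ∷_) (u ш v)

  shuffleʳ : LWord → LWord → List LWord
  shuffleʳ u [] = []
  shuffleʳ u (q ∷ v) = map (q ∷_) (u ш v)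

  shuffleᵉ : LWord → LWord → List LWord
  shuffleᵉ [] [] = [] ∷ []
  shuffleᵉ [] (_ ∷ _) = []
  shuffleᵉ (_ ∷ _) _ = []

  ш-identityʳ : ∀ u → u ш [] ≡ u ∷ []
  ш-identityʳ [] = refl
  ш-identityʳ (p ∷ u) = refl

  ш-split : ∀ u v → u ш v ↭ shuffleˡ u v ++ shuffleʳ u v ++ shuffleᵉ u v
  ш-split [] [] = ↭-refl
  ш-split [] (q ∷ v) = ↭-refl
  ш-split (p ∷ u) [] rewrite ш-identityʳ u = ↭-refl
  ш-split (p ∷ u) (q ∷ v) = ↭-reflexive (cong (map (p ∷_) (u ш (q ∷ v)) ++_) (sym (LP.++-identityʳ _)))

  shuffleAllˡ shuffleAllʳ shuffleAllᵉ : List LWord → List LWord → List LWord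
  shuffleAllˡ A B = concatMap (λ u → concatMap (λ v → shuffleˡ u v) B) A
  shuffleAllʳ A B = concatMap (λ u → concatMap (λ v → shuffleʳ u v) B) A
  shuffleAllᵉ A B = concatMap (λ u → concatMap (λ v → shuffleᵉ u v) B) A

  shuffleAll-split : ∀ A B → shuffleAll A B ↭ shuffleAllˡ A B ++ shuffleAllʳ A B ++ shuffleAllᵉ A B
  shuffleAll-split A B =
    ↭-trans (concatMap-cong-↭ A (λ u →
      ↭-trans (concatMap-cong-↭ B (λ v → ш-split u v))
      (↭-trans (concatMap-pointwise-++ (shuffleˡ u) (λ v → shuffleʳ u v ++ shuffleᵉ u v) B)
        (++⁺ˡ _ (concatMap-pointwise-++ (shuffleʳ u) (shuffleᵉ u) B)))))
    (↭-trans (concatMap-pointwise-++ (λ u → concatMap (shuffleˡ u) B) (λ u → concatMap (shuffleʳ u) B ++ concatMap (shuffleᵉ u) B) A)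
      (++⁺ˡ _ (concatMap-pointwise-++ (λ u → concatMap (shuffleʳ u) B) (λ u → concatMap (shuffleᵉ u) B) A)))

  module _ (g G : LWord → List LWord) (hyp : ∀ p u → g (p ∷ u) ≡ map (p ∷_) (G u)) {n : ℕ} where
    private
      expandThen : Expander {n}
      expandThen S c d e = concatMap G (expansion S c d e)

      concatMap-prefixed : ∀ p V → concatMap g (map (p ∷_) V) ≡ map (p ∷_) (concatMap G V)
      concatMap-prefixed p V = trans (LP.concatMap-map g (p ∷_) V)
               (trans (LP.concatMap-cong (λ u → hyp p u) V) (sym (LP.map-concatMap (p ∷_) G V)))

    concatMap-expansion : ∀ (S : List (Fin n)) c d e →
      concatMap g (expansion S c d e) ≡ xStep expandThen S c d e ++ yStep expandThen S c d e ++ concatMap g (endStep c d)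
    concatMap-expansion S c d e rewrite expansion-unfold S c d e
      | LP.concatMap-++ g (xStep expansion S c d e) (yStep expansion S c d e ++ endStep c d)
      | LP.concatMap-++ g (yStep expansion S c d e) (endStep c d) = cong₂ _++_ (xPart d e) (cong (_++ _) (yPart c))
      where
        xPart : ∀ d e → concatMap g (xStep expansion S c d e) ≡ xStep expandThen S c d e
        xPart zero e = refl
        xPart (suc d) e = trans (concatMap-concatMap g _ S) (LP.concatMap-cong (λ l → atExponent l (lookup e l)) S)
          where atExponent : ∀ l k → concatMap g (xStepAt expansion S c d e l k) ≡ xStepAt expandThen S c d e l k
                atExponent l zero = refl
                atExponent l (suc k) = concatMap-prefixed x (expansion S c d (e [ l ]≔ k))
        yPart : ∀ c → concatMap g (yStep expansion S c d e) ≡ yStep expandThen S c d e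
        yPart [] = refl
        yPart ((a , l) ∷ c) = concatMap-prefixed (y a) (expansion (S ++ l ∷ []) c d e)

  module _ (g : LWord → List LWord) (hyp : ∀ p u → g (p ∷ u) ≡ []) {n : ℕ} where
    private
      concatMap-prefixed : ∀ p V → concatMap g (map (p ∷_) V) ≡ []
      concatMap-prefixed p V = trans (LP.concatMap-map g (p ∷_) V) (concatMap-[] _ V (λ u → hyp p u))

    concatMap-expansion-only-end : ∀ (S : List (Fin n)) c d e → concatMap g (expansion S c d e) ≡ concatMap g (endStep c d)
    concatMap-expansion-only-end S c d e rewrite expansion-unfold S c d e
      | LP.concatMap-++ g (xStep expansion S c d e) (yStep expansion S c d e ++ endStep c d)
      | LP.concatMap-++ g (yStep expansion S c d e) (endStep c d) = cong₂ _++_ (xPart d e) (cong (_++ _) (yPart c))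
      where
        xPart : ∀ d e → concatMap g (xStep expansion S c d e) ≡ []
        xPart zero e = refl
        xPart (suc d) e = trans (concatMap-concatMap g _ S) (concatMap-[] _ S (λ l → atExponent l (lookup e l)))
          where atExponent : ∀ l k → concatMap g (xStepAt expansion S c d e l k) ≡ []
                atExponent l zero = refl
                atExponent l (suc k) = concatMap-prefixed x (expansion S c d (e [ l ]≔ k))
        yPart : ∀ c → concatMap g (yStep expansion S c d e) ≡ []
        yPart [] = refl
        yPart ((a , l) ∷ c) = concatMap-prefixed (y a) (expansion (S ++ l ∷ []) c d e)

  concatMap-endStep : ∀ (g : LWord → List LWord) → g [] ≡ [] → ∀ {n} (c : Letters n) d → concatMap g (endStep c d) ≡ []
  concatMap-endStep g h [] zero rewrite h = refl
  concatMap-endStep g h [] (suc d) = refl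
  concatMap-endStep g h (_ ∷ _) d = refl

  endPairs : ∀ {n1 n2} → Letters n1 → ℕ → Letters n2 → ℕ → List LWord
  endPairs c1 d1 c2 d2 = concatMap (λ u → concatMap (λ v → shuffleᵉ u v) (endStep c2 d2)) (endStep c1 d1)

  shuffleAll′ : List LWord → List LWord → List LWord
  shuffleAll′ A B = concatMap (λ v → concatMap (λ u → u ш v) A) B

  module _ {n : ℕ} where
    shuffleAllˡ-expansion : ∀ B (S : List (Fin n)) c d e →
      shuffleAllˡ (expansion S c d e) B ≡ xStep (λ S c d e → shuffleAll (expansion S c d e) B) S c d e
                         ++ yStep (λ S c d e → shuffleAll (expansion S c d e) B) S c d e ++ []
    shuffleAllˡ-expansion B S c d e =
      trans (concatMap-expansion (λ u → concatMap (λ v → shuffleˡ u v) B) (λ u → concatMap (λ v → u ш v) B)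
                   (λ p u → sym (LP.map-concatMap (p ∷_) (λ v → u ш v) B)) S c d e)
        (cong (λ z → xStep _ S c d e ++ yStep _ S c d e ++ z)
           (concatMap-endStep _ (concatMap-[] (λ v → []) B (λ _ → refl)) c d))

    shuffleAllʳ-expansion : ∀ A (S : List (Fin n)) c d e →
      shuffleAllʳ A (expansion S c d e) ↭ xStep (λ S c d e → shuffleAll′ A (expansion S c d e)) S c d e
                         ++ yStep (λ S c d e → shuffleAll′ A (expansion S c d e)) S c d e ++ []
    shuffleAllʳ-expansion A S c d e =
      ↭-trans (concatMap-comm (λ u v → shuffleʳ u v) A (expansion S c d e))
      (↭-reflexive
        (trans (concatMap-expansion (λ v → concatMap (λ u → shuffleʳ u v) A) (λ v → concatMap (λ u → u ш v) A)
                   (λ q v → sym (LP.map-concatMap (q ∷_) (λ u → u ш v) A)) S c d e)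
        (cong (λ z → xStep _ S c d e ++ yStep _ S c d e ++ z)
           (concatMap-endStep _ (concatMap-[] (λ u → []) A (λ _ → refl)) c d))))

  module _ {n1 n2 : ℕ} where
    shuffleAllᵉ-expansion : ∀ (S1 : List (Fin n1)) c1 d1 e1 (S2 : List (Fin n2)) c2 d2 e2 →
      shuffleAllᵉ (expansion S1 c1 d1 e1) (expansion S2 c2 d2 e2) ≡ endPairs c1 d1 c2 d2
    shuffleAllᵉ-expansion S1 c1 d1 e1 S2 c2 d2 e2 =
      trans (concatMap-expansion-only-end (λ u → concatMap (λ v → shuffleᵉ u v) (expansion S2 c2 d2 e2))
                    (λ p u → concatMap-[] (λ v → shuffleᵉ (p ∷ u) v) (expansion S2 c2 d2 e2) (λ _ → refl)) S1 c1 d1 e1)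
        (LP.concatMap-cong (λ u → concatMap-expansion-only-end (λ v → shuffleᵉ u v) (λ p v → shuffleᵉ-∷ʳ u p v) S2 c2 d2 e2) (endStep c1 d1))
      where shuffleᵉ-∷ʳ : ∀ u p v → shuffleᵉ u (p ∷ v) ≡ []
            shuffleᵉ-∷ʳ [] p v = refl
            shuffleᵉ-∷ʳ (_ ∷ _) p v = refl

  interleavings : ∀ {A : Set} → List A → List A → List (List A)
  interleavings [] v = v ∷ []
  interleavings (a ∷ u) [] = map (a ∷_) (interleavings u [])
  interleavings (a ∷ u) (b ∷ v) = map (a ∷_) (interleavings u (b ∷ v)) ++ map (b ∷_) (interleavings (a ∷ u) v)

  -- The x's still to be written cover the exponents of all active and pending variables
  -- (with equality in every use), so running out of x's means every exponent is used up.
  Budget : ∀ {n} → List (Fin n) → Letters n → ℕ → Vec ℕ n → Set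
  Budget S c d e = sumOver S e + sumOver (map proj₂ c) e ≤ d

  budget-exhausted : ∀ {n} (S : List (Fin n)) c e l → Budget S c zero e → l ∈ S → lookup e l ≡ 0
  budget-exhausted S c e l bud l∈ = n≤0⇒n≡0 (≤-trans (lookup≤sumOver S e l l∈) (≤-trans (m≤m+n _ _) bud))

  budget-xStep : ∀ {n} (S : List (Fin n)) c d e l k → Budget S c (suc d) e → l ∈ S → lookup e l ≡ suc k →
          Budget S c d (e [ l ]≔ k)
  budget-xStep S c d e l k bud l∈ eq = ≤-pred (≤-trans (s≤s (+-monoʳ-≤ _ (sumOver-decrement-≤ (map proj₂ c) e l k eq)))
                                    (≤-trans (+-monoˡ-≤ _ (sumOver-decrement-< S e l k l∈ eq)) bud))

  budget-yStep : ∀ {n} (S : List (Fin n)) a l c d e → Budget S ((a , l) ∷ c) d e → Budget (S ++ l ∷ []) c d e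
  budget-yStep S a l c d e bud = subst (_≤ d) eq bud
    where eq : sumOver S e + (lookup e l + sumOver (map proj₂ c) e) ≡ sumOver (S ++ l ∷ []) e + sumOver (map proj₂ c) e
          eq rewrite sumOver-++ S (l ∷ []) e | +-identityʳ (lookup e l) = sym (+-assoc (sumOver S e) _ _)

  module _ {n1 n2 : ℕ} where
    liftˡ : Fin n1 → Fin (n1 + n2)
    liftˡ l = l ↑ˡ n2
    liftʳ : Fin n2 → Fin (n1 + n2)
    liftʳ l = n1 ↑ʳ l
    liftLetterˡ : ZN × Fin n1 → ZN × Fin (n1 + n2)
    liftLetterˡ (a , l) = a , liftˡ l
    liftLetterʳ : ZN × Fin n2 → ZN × Fin (n1 + n2)
    liftLetterʳ (a , l) = a , liftʳ l

    interleavedExpansion : List (Fin n1) → Letters n1 → ℕ → Vec ℕ n1 → List (Fin n2) → Letters n2 → ℕ → Vec ℕ n2 → List LWord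
    interleavedExpansion S1 c1 d1 e1 S2 c2 d2 e2 =
      concatMap (λ w → expansion (map liftˡ S1 ++ map liftʳ S2) w (d1 + d2) (e1 ++ᵛ e2))
                (interleavings (map liftLetterˡ c1) (map liftLetterʳ c2))

    expandEach : List (Letters (n1 + n2)) → Expander {n1 + n2}
    expandEach W S c d e = concatMap (λ w → expansion S w d e) W

    expandEach-unfold : ∀ (S : List (Fin (n1 + n2))) W D E → concatMap (λ w → expansion S w D E) W ↭
      concatMap (λ w → xStep expansion S w D E) W ++ concatMap (λ w → yStep expansion S w D E) W ++ concatMap (λ w → endStep w D) W
    expandEach-unfold S W D E = ↭-trans (↭-reflexive (LP.concatMap-cong (λ w → expansion-unfold S w D E) W))
                        (↭-trans (concatMap-pointwise-++ _ _ W) (++⁺ˡ _ (concatMap-pointwise-++ _ _ W)))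

    expandEach-xStep : ∀ (S : List (Fin (n1 + n2))) W D E → concatMap (λ w → xStep expansion S w D E) W ↭ xStep (expandEach W) S [] D E
    expandEach-xStep S W zero E = ↭-reflexive (concatMap-[] _ W (λ _ → refl))
    expandEach-xStep S W (suc D) E = ↭-trans (concatMap-comm (λ w l → xStepAt expansion S w D E l (lookup E l)) W S)
                          (↭-reflexive (LP.concatMap-cong (λ l → atExponent l (lookup E l)) S))
      where atExponent : ∀ l k → concatMap (λ w → xStepAt expansion S w D E l k) W ≡ xStepAt (expandEach W) S [] D E l k
            atExponent l zero = concatMap-[] _ W (λ _ → refl)
            atExponent l (suc k) = sym (LP.map-concatMap (x ∷_) (λ w → expansion S w D (E [ l ]≔ k)) W)

    module _ (S1 : List (Fin n1)) (c1 : Letters n1) (d1 : ℕ) (e1 : Vec ℕ n1)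
             (S2 : List (Fin n2)) (c2 : Letters n2) (d2 : ℕ) (e2 : Vec ℕ n2) where
      private
        S' = map liftˡ S1 ++ map liftʳ S2
        W = interleavings (map liftLetterˡ c1) (map liftLetterʳ c2)
        E = e1 ++ᵛ e2
      interleavedˡ : Expander {n1}
      interleavedˡ S c d e = interleavedExpansion S c d e S2 c2 d2 e2
      interleavedʳ : Expander {n2}
      interleavedʳ S c d e = interleavedExpansion S1 c1 d1 e1 S c d e

      xStepAt-liftˡ : ∀ D' d₁' → D' ≡ d₁' + d2 → ∀ l →
        xStepAt (expandEach W) S' [] D' E (liftˡ l) (lookup E (liftˡ l)) ≡
        xStepAt interleavedˡ S1 c1 d₁' e1 l (lookup e1 l)
      xStepAt-liftˡ D' d₁' eq l rewrite lookup-++ˡ e1 e2 l = atExponent (lookup e1 l)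
        where atExponent : ∀ k → xStepAt (expandEach W) S' [] D' E (liftˡ l) k ≡ xStepAt interleavedˡ S1 c1 d₁' e1 l k
              atExponent zero = refl
              atExponent (suc k) rewrite eq | []≔-++-↑ˡ {x = k} e1 e2 l = refl

      xStepAt-liftʳ : ∀ D' d₂' → D' ≡ d1 + d₂' → ∀ l →
        xStepAt (expandEach W) S' [] D' E (liftʳ l) (lookup E (liftʳ l)) ≡
        xStepAt interleavedʳ S2 c2 d₂' e2 l (lookup e2 l)
      xStepAt-liftʳ D' d₂' eq l rewrite lookup-++ʳ e1 e2 l = atExponent (lookup e2 l)
        where atExponent : ∀ k → xStepAt (expandEach W) S' [] D' E (liftʳ l) k ≡ xStepAt interleavedʳ S2 c2 d₂' e2 l k
              atExponent zero = refl
              atExponent (suc k) rewrite eq | []≔-++-↑ʳ {y = k} e1 e2 l = refl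

      xStep-liftˡ-exhausted : ∀ D' → d1 ≡ 0 → Budget S1 c1 d1 e1 →
        concatMap (λ l → xStepAt (expandEach W) S' [] D' E l (lookup E l)) (map liftˡ S1) ≡ []
      xStep-liftˡ-exhausted D' refl bud = trans (LP.concatMap-map _ liftˡ S1) (concatMap-[]-∈ _ S1 (λ l l∈ →
         cong (xStepAt (expandEach W) S' [] D' E (liftˡ l)) (trans (lookup-++ˡ e1 e2 l) (budget-exhausted S1 c1 e1 l bud l∈))))

      xStep-liftʳ-exhausted : ∀ D' → d2 ≡ 0 → Budget S2 c2 d2 e2 →
        concatMap (λ l → xStepAt (expandEach W) S' [] D' E l (lookup E l)) (map liftʳ S2) ≡ []
      xStep-liftʳ-exhausted D' refl bud = trans (LP.concatMap-map _ liftʳ S2) (concatMap-[]-∈ _ S2 (λ l l∈ →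
         cong (xStepAt (expandEach W) S' [] D' E (liftʳ l)) (trans (lookup-++ʳ e1 e2 l) (budget-exhausted S2 c2 e2 l bud l∈))))

      xStep-interleavings : Budget S1 c1 d1 e1 → Budget S2 c2 d2 e2 →
        xStep (expandEach W) S' [] (d1 + d2) E ≡ xStep interleavedˡ S1 c1 d1 e1 ++ xStep interleavedʳ S2 c2 d2 e2
      xStep-interleavings bud₁ bud₂ = byDegrees d1 d2 refl refl
        where
          byDegrees : ∀ a b → a ≡ d1 → b ≡ d2 → xStep (expandEach W) S' [] (d1 + d2) E ≡ xStep interleavedˡ S1 c1 d1 e1 ++ xStep interleavedʳ S2 c2 d2 e2
          byDegrees zero zero refl refl = refl
          byDegrees (suc a) b refl refl =
            trans (LP.concatMap-++ _ (map liftˡ S1) (map liftʳ S2))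
              (cong₂ _++_ (trans (LP.concatMap-map _ liftˡ S1) (LP.concatMap-cong (xStepAt-liftˡ (a + d2) a refl) S1))
                          (rightPart b refl))
            where
              rightPart : ∀ b' → b' ≡ d2 → concatMap (λ l → xStepAt (expandEach W) S' [] (a + d2) E l (lookup E l)) (map liftʳ S2)
                                     ≡ xStep interleavedʳ S2 c2 d2 e2
              rightPart zero refl = xStep-liftʳ-exhausted (a + d2) refl bud₂
              rightPart (suc b') refl = trans (LP.concatMap-map _ liftʳ S2)
                                      (LP.concatMap-cong (xStepAt-liftʳ (a + suc b') b' (+-suc a b')) S2)
          byDegrees zero (suc b) refl refl =
            trans (LP.concatMap-++ _ (map liftˡ S1) (map liftʳ S2))
              (cong₂ _++_ (xStep-liftˡ-exhausted b refl bud₁)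
                          (trans (LP.concatMap-map _ liftʳ S2) (LP.concatMap-cong (xStepAt-liftʳ b b refl) S2)))

      concatMap-yStep-cons : ∀ (S : List (Fin (n1 + n2))) D (a : ZN) l W' →
        concatMap (λ w → yStep expansion S w D E) (map ((a , l) ∷_) W') ≡
        map (y a ∷_) (concatMap (λ ws → expansion (S ++ l ∷ []) ws D E) W')
      concatMap-yStep-cons S D a l W' = trans (LP.concatMap-map _ _ W') (sym (LP.map-concatMap (y a ∷_) (λ ws → expansion (S ++ l ∷ []) ws D E) W'))

    activate-liftˡ : ∀ (S1 : List (Fin n1)) (S2 : List (Fin n2)) l →
      (map liftˡ S1 ++ map liftʳ S2) ++ liftˡ l ∷ [] ↭ map liftˡ (S1 ++ l ∷ []) ++ map liftʳ S2
    activate-liftˡ S1 S2 l rewrite LP.map-++ liftˡ S1 (l ∷ []) =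
      ↭-trans (↭-++-assoc (map liftˡ S1) (map liftʳ S2) _)
      (↭-trans (++⁺ˡ (map liftˡ S1) (++-comm (map liftʳ S2) (liftˡ l ∷ [])))
        (↭-sym (↭-++-assoc (map liftˡ S1) (liftˡ l ∷ []) _)))

    activate-liftʳ : ∀ (S1 : List (Fin n1)) (S2 : List (Fin n2)) l →
      (map liftˡ S1 ++ map liftʳ S2) ++ liftʳ l ∷ [] ≡ map liftˡ S1 ++ map liftʳ (S2 ++ l ∷ [])
    activate-liftʳ S1 S2 l rewrite LP.map-++ liftʳ S2 (l ∷ []) = LP.++-assoc (map liftˡ S1) (map liftʳ S2) _

    yStep-interleavings : ∀ (S1 : List (Fin n1)) c1 d1 e1 (S2 : List (Fin n2)) c2 d2 e2 →
      concatMap (λ w → yStep expansion (map liftˡ S1 ++ map liftʳ S2) w (d1 + d2) (e1 ++ᵛ e2))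
                (interleavings (map liftLetterˡ c1) (map liftLetterʳ c2))
      ↭ yStep (interleavedˡ S1 c1 d1 e1 S2 c2 d2 e2) S1 c1 d1 e1 ++ yStep (interleavedʳ S1 c1 d1 e1 S2 c2 d2 e2) S2 c2 d2 e2
    yStep-interleavings S1 [] d1 e1 S2 [] d2 e2 = ↭-refl
    yStep-interleavings S1 [] d1 e1 S2 ((b , l) ∷ c2) d2 e2 =
      ↭-reflexive (trans (LP.++-identityʳ _) (cong (map (y b ∷_))
        (trans (cong (λ S → expansion S (map liftLetterʳ c2) (d1 + d2) (e1 ++ᵛ e2)) (activate-liftʳ S1 S2 l))
                 (sym (LP.++-identityʳ _)))))
    yStep-interleavings S1 ((a , l) ∷ c1) d1 e1 S2 [] d2 e2 =
      ↭-trans (↭-reflexive (concatMap-yStep-cons S1 ((a , l) ∷ c1) d1 e1 S2 [] d2 e2 _ (d1 + d2) a (liftˡ l) (interleavings (map liftLetterˡ c1) [])))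
      (↭-trans (map⁺ (y a ∷_) (concatMap-cong-↭ (interleavings (map liftLetterˡ c1) []) (λ w → expansion-resp-↭ w (d1 + d2) (e1 ++ᵛ e2) (activate-liftˡ S1 S2 l))))
        (↭-sym (↭-++-identityʳ _)))
    yStep-interleavings S1 ((a , l) ∷ c1) d1 e1 S2 ((b , l2) ∷ c2) d2 e2 =
      ↭-trans (↭-reflexive (LP.concatMap-++ _ (map ((a , liftˡ l) ∷_) W1) (map ((b , liftʳ l2) ∷_) W2)))
      (++⁺ (↭-trans (↭-reflexive (concatMap-yStep-cons S1 c1' d1 e1 S2 c2' d2 e2 _ (d1 + d2) a (liftˡ l) W1))
                    (map⁺ (y a ∷_) (concatMap-cong-↭ W1 (λ w → expansion-resp-↭ w (d1 + d2) (e1 ++ᵛ e2) (activate-liftˡ S1 S2 l)))))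
           (↭-reflexive (trans (concatMap-yStep-cons S1 c1' d1 e1 S2 c2' d2 e2 _ (d1 + d2) b (liftʳ l2) W2)
               (cong (map (y b ∷_)) (LP.concatMap-cong (λ w → cong (λ S → expansion S w (d1 + d2) (e1 ++ᵛ e2)) (activate-liftʳ S1 S2 l2)) W2)))))
      where c1' = (a , l) ∷ c1
            c2' = (b , l2) ∷ c2
            W1 = interleavings (map liftLetterˡ c1) ((b , liftʳ l2) ∷ map liftLetterʳ c2)
            W2 = interleavings ((a , liftˡ l) ∷ map liftLetterˡ c1) (map liftLetterʳ c2)

    endStep-interleavings : ∀ (c1 : Letters n1) d1 (c2 : Letters n2) d2 →
      concatMap (λ w → endStep w (d1 + d2)) (interleavings (map liftLetterˡ c1) (map liftLetterʳ c2)) ≡ endPairs c1 d1 c2 d2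
    endStep-interleavings [] zero [] zero = refl
    endStep-interleavings [] zero [] (suc d2) = refl
    endStep-interleavings [] (suc d1) [] d2 = refl
    endStep-interleavings [] zero (q ∷ c2) d2 = refl
    endStep-interleavings [] (suc d1) (q ∷ c2) d2 = refl
    endStep-interleavings (p ∷ c1) d1 [] d2 = trans (LP.concatMap-map _ _ (interleavings (map liftLetterˡ c1) []))
      (concatMap-[] (λ w → endStep (liftLetterˡ p ∷ w) (d1 + d2)) (interleavings (map liftLetterˡ c1) []) (λ _ → refl))
    endStep-interleavings (p ∷ c1) d1 (q ∷ c2) d2 =
      trans (LP.concatMap-++ _ (map (liftLetterˡ p ∷_) (interleavings (map liftLetterˡ c1) (liftLetterʳ q ∷ map liftLetterʳ c2)))
                                 (map (liftLetterʳ q ∷_) (interleavings (liftLetterˡ p ∷ map liftLetterˡ c1) (map liftLetterʳ c2))))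
        (cong₂ _++_ (trans (LP.concatMap-map _ _ (interleavings (map liftLetterˡ c1) (liftLetterʳ q ∷ map liftLetterʳ c2)))
                       (concatMap-[] (λ w → endStep (liftLetterˡ p ∷ w) (d1 + d2)) (interleavings (map liftLetterˡ c1) (liftLetterʳ q ∷ map liftLetterʳ c2)) (λ _ → refl)))
                    (trans (LP.concatMap-map _ _ (interleavings (liftLetterˡ p ∷ map liftLetterˡ c1) (map liftLetterʳ c2)))
                       (concatMap-[] (λ w → endStep (liftLetterʳ q ∷ w) (d1 + d2)) (interleavings (liftLetterˡ p ∷ map liftLetterˡ c1) (map liftLetterʳ c2)) (λ _ → refl))))

    ++-interchange-↭ : ∀ (X₁ Y₁ X₂ Y₂ E : List LWord) →
      (X₁ ++ Y₁ ++ []) ++ (X₂ ++ Y₂ ++ []) ++ E ↭ (X₁ ++ X₂) ++ (Y₁ ++ Y₂) ++ E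
    ++-interchange-↭ X₁ Y₁ X₂ Y₂ E rewrite LP.++-identityʳ Y₁ | LP.++-identityʳ Y₂
      | LP.++-assoc X₁ Y₁ ((X₂ ++ Y₂) ++ E) | LP.++-assoc X₂ Y₂ E
      | LP.++-assoc X₁ X₂ ((Y₁ ++ Y₂) ++ E) | LP.++-assoc Y₁ Y₂ E = ++⁺ˡ X₁ (shifts Y₁ X₂)

    module _ (S1 : List (Fin n1)) (c1 : Letters n1) (d1 : ℕ) (e1 : Vec ℕ n1)
             (S2 : List (Fin n2)) (c2 : Letters n2) (d2 : ℕ) (e2 : Vec ℕ n2) where
      private
        A = expansion S1 c1 d1 e1
        B = expansion S2 c2 d2 e2

      shuffledˡ : Expander {n1}
      shuffledʳ : Expander {n2}
      shuffledˡ S c d e = shuffleAll (expansion S c d e) B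
      shuffledʳ S c d e = shuffleAll′ A (expansion S c d e)

      shuffleAll-expansion-unfold :
        shuffleAll A B ↭ (xStep shuffledˡ S1 c1 d1 e1 ++ xStep shuffledʳ S2 c2 d2 e2)
                         ++ (yStep shuffledˡ S1 c1 d1 e1 ++ yStep shuffledʳ S2 c2 d2 e2) ++ endPairs c1 d1 c2 d2
      shuffleAll-expansion-unfold =
        ↭-trans (shuffleAll-split A B)
        (↭-trans (++⁺ (↭-reflexive (shuffleAllˡ-expansion B S1 c1 d1 e1))
                      (++⁺ (shuffleAllʳ-expansion A S2 c2 d2 e2) (↭-reflexive (shuffleAllᵉ-expansion S1 c1 d1 e1 S2 c2 d2 e2))))
                 (++-interchange-↭ (xStep shuffledˡ S1 c1 d1 e1) (yStep shuffledˡ S1 c1 d1 e1)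
                                   (xStep shuffledʳ S2 c2 d2 e2) (yStep shuffledʳ S2 c2 d2 e2) (endPairs c1 d1 c2 d2)))

      interleavedExpansion-unfold : Budget S1 c1 d1 e1 → Budget S2 c2 d2 e2 →
        interleavedExpansion S1 c1 d1 e1 S2 c2 d2 e2
          ↭ (xStep (interleavedˡ S1 c1 d1 e1 S2 c2 d2 e2) S1 c1 d1 e1 ++ xStep (interleavedʳ S1 c1 d1 e1 S2 c2 d2 e2) S2 c2 d2 e2)
            ++ (yStep (interleavedˡ S1 c1 d1 e1 S2 c2 d2 e2) S1 c1 d1 e1 ++ yStep (interleavedʳ S1 c1 d1 e1 S2 c2 d2 e2) S2 c2 d2 e2)
            ++ endPairs c1 d1 c2 d2
      interleavedExpansion-unfold b1 b2 =
        ↭-trans (expandEach-unfold S' W (d1 + d2) (e1 ++ᵛ e2))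
          (++⁺ (↭-trans (expandEach-xStep S' W (d1 + d2) (e1 ++ᵛ e2)) (↭-reflexive (xStep-interleavings S1 c1 d1 e1 S2 c2 d2 e2 b1 b2)))
          (++⁺ (yStep-interleavings S1 c1 d1 e1 S2 c2 d2 e2) (↭-reflexive (endStep-interleavings c1 d1 c2 d2))))
        where
          S' = map liftˡ S1 ++ map liftʳ S2
          W = interleavings (map liftLetterˡ c1) (map liftLetterʳ c2)

    -- A shuffle of two words begins with the first letter of one of them; for words of the two
    -- expansions this letter is an x or the next y of that side, which is exactly how the expansion
    -- of an interleaving of the two letter sequences begins.
    shuffle-expansion-↭ : ∀ fuel (S1 : List (Fin n1)) c1 d1 e1 (S2 : List (Fin n2)) c2 d2 e2 →
      length c1 + length c2 + (d1 + d2) < fuel → Budget S1 c1 d1 e1 → Budget S2 c2 d2 e2 →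
      shuffleAll (expansion S1 c1 d1 e1) (expansion S2 c2 d2 e2) ↭ interleavedExpansion S1 c1 d1 e1 S2 c2 d2 e2
    shuffle-expansion-↭ (suc fuel) S1 c1 d1 e1 S2 c2 d2 e2 size< b1 b2 =
      ↭-trans (shuffleAll-expansion-unfold S1 c1 d1 e1 S2 c2 d2 e2)
      (↭-trans (++⁺ (++⁺ (xStep-cong shL intL S1 c1 d1 e1 ihˣ₁) (xStep-cong shR intR S2 c2 d2 e2 ihˣ₂))
                    (++⁺ (++⁺ (yStep-cong shL intL S1 c1 d1 e1 ihʸ₁) (yStep-cong shR intR S2 c2 d2 e2 ihʸ₂)) ↭-refl))
               (↭-sym (interleavedExpansion-unfold S1 c1 d1 e1 S2 c2 d2 e2 b1 b2)))
      where
        A = expansion S1 c1 d1 e1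
        shL intL : Expander {n1}
        shL = shuffledˡ S1 c1 d1 e1 S2 c2 d2 e2
        intL = interleavedˡ S1 c1 d1 e1 S2 c2 d2 e2
        shR intR : Expander {n2}
        shR = shuffledʳ S1 c1 d1 e1 S2 c2 d2 e2
        intR = interleavedʳ S1 c1 d1 e1 S2 c2 d2 e2
        size≤ : length c1 + length c2 + (d1 + d2) ≤ fuel
        size≤ = ≤-pred size<
        ihˣ₁ : ∀ d' l k → d1 ≡ suc d' → l ∈ S1 → lookup e1 l ≡ suc k →
               shL S1 c1 d' (e1 [ l ]≔ k) ↭ interleavedExpansion S1 c1 d' (e1 [ l ]≔ k) S2 c2 d2 e2
        ihˣ₁ d' l k refl l∈ eq = shuffle-expansion-↭ fuel S1 c1 d' (e1 [ l ]≔ k) S2 c2 d2 e2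
          (<-≤-trans (+-monoʳ-< (length c1 + length c2) (+-monoˡ-< d2 (n<1+n d'))) size≤)
          (budget-xStep S1 c1 d' e1 l k b1 l∈ eq) b2
        ihʸ₁ : ∀ a l c' → c1 ≡ (a , l) ∷ c' →
               shL (S1 ++ l ∷ []) c' d1 e1 ↭ interleavedExpansion (S1 ++ l ∷ []) c' d1 e1 S2 c2 d2 e2
        ihʸ₁ a l c' refl = shuffle-expansion-↭ fuel (S1 ++ l ∷ []) c' d1 e1 S2 c2 d2 e2
          (<-≤-trans (n<1+n _) size≤) (budget-yStep S1 a l c' d1 e1 b1) b2
        ihˣ₂ : ∀ d' l k → d2 ≡ suc d' → l ∈ S2 → lookup e2 l ≡ suc k →
               shR S2 c2 d' (e2 [ l ]≔ k) ↭ interleavedExpansion S1 c1 d1 e1 S2 c2 d' (e2 [ l ]≔ k)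
        ihˣ₂ d' l k refl l∈ eq = ↭-trans (concatMap-comm (λ v u → u ш v) (expansion S2 c2 d' (e2 [ l ]≔ k)) A)
          (shuffle-expansion-↭ fuel S1 c1 d1 e1 S2 c2 d' (e2 [ l ]≔ k)
            (<-≤-trans (+-monoʳ-< (length c1 + length c2) (+-monoʳ-< d1 (n<1+n d'))) size≤)
            b1 (budget-xStep S2 c2 d' e2 l k b2 l∈ eq))
        ihʸ₂ : ∀ a l c' → c2 ≡ (a , l) ∷ c' →
               shR (S2 ++ l ∷ []) c' d2 e2 ↭ interleavedExpansion S1 c1 d1 e1 (S2 ++ l ∷ []) c' d2 e2
        ihʸ₂ a l c' refl = ↭-trans (concatMap-comm (λ v u → u ш v) (expansion (S2 ++ l ∷ []) c' d2 e2) A)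
          (shuffle-expansion-↭ fuel S1 c1 d1 e1 (S2 ++ l ∷ []) c' d2 e2
            (<-≤-trans (+-monoˡ-< (d1 + d2) (+-monoʳ-< (length c1) (n<1+n (length c')))) size≤)
            b1 (budget-yStep S2 a l c' d2 e2 b2))


module RingSums {c ℓ : Level} (K : CommutativeRing c ℓ) where

  open Series K
  open CommutativeRing K
  open import Algebra.Properties.CommutativeSemigroup +-commutativeSemigroup using (interchange)
  import Algebra.Properties.AbelianGroup +-abelianGroup as +-AbelianGroup
  open import Data.Nat using (ℕ; zero; suc) renaming (_+_ to _+ℕ_)
  open import Data.List using (List; []; _∷_; _++_; map; concatMap; foldr; filter)
  import Data.List.Properties as LP
  open import Data.List.Relation.Binary.Permutation.Propositional using (_↭_; ↭⇒↭ₛ′)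
  import Data.List.Relation.Binary.Permutation.Propositional.Properties as PP
  import Data.List.Relation.Binary.Permutation.Setoid.Properties as PS
  open import Data.List.Relation.Unary.All using (All; []; _∷_)
  open import Relation.Binary.PropositionalEquality as ≡ using (_≡_)
  open import Relation.Nullary using (yes; no)
  open import Relation.Nullary.Decidable using (¬?)
  open import Relation.Unary using (Pred; Decidable)

  ΣL-++ : ∀ (xs ys : List Carrier) → ΣL (xs ++ ys) ≈ ΣL xs + ΣL ys
  ΣL-++ [] ys = sym (+-identityˡ _)
  ΣL-++ (x ∷ xs) ys = trans (+-congˡ (ΣL-++ xs ys)) (sym (+-assoc x _ _))

  module _ {A : Set} where
    ΣL-map-++ : ∀ (h : A → Carrier) xs ys → ΣL (map h (xs ++ ys)) ≈ ΣL (map h xs) + ΣL (map h ys)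
    ΣL-map-++ h xs ys = trans (reflexive (≡.cong ΣL (LP.map-++ h xs ys))) (ΣL-++ (map h xs) _)

    ΣL-cong : ∀ {f g : A → Carrier} (xs : List A) → (∀ x → f x ≈ g x) → ΣL (map f xs) ≈ ΣL (map g xs)
    ΣL-cong [] h = refl
    ΣL-cong (x ∷ xs) h = +-cong (h x) (ΣL-cong xs h)

    ΣL-cong-All : ∀ {f g : A → Carrier} {xs : List A} → All (λ x → f x ≈ g x) xs → ΣL (map f xs) ≈ ΣL (map g xs)
    ΣL-cong-All [] = refl
    ΣL-cong-All (p ∷ ps) = +-cong p (ΣL-cong-All ps)

    ΣL-zero-All : ∀ {f : A → Carrier} {xs : List A} → All (λ x → f x ≈ 0#) xs → ΣL (map f xs) ≈ 0#
    ΣL-zero-All [] = refl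
    ΣL-zero-All (p ∷ ps) = trans (+-cong p (ΣL-zero-All ps)) (+-identityˡ 0#)

    ΣL-zero : ∀ {f : A → Carrier} (xs : List A) → (∀ x → f x ≈ 0#) → ΣL (map f xs) ≈ 0#
    ΣL-zero [] h = refl
    ΣL-zero (x ∷ xs) h = trans (+-cong (h x) (ΣL-zero xs h)) (+-identityˡ 0#)

    ΣL-+ : ∀ (f g : A → Carrier) (xs : List A) → ΣL (map (λ x → f x + g x) xs) ≈ ΣL (map f xs) + ΣL (map g xs)
    ΣL-+ f g [] = sym (+-identityˡ 0#)
    ΣL-+ f g (x ∷ xs) = trans (+-congˡ (ΣL-+ f g xs)) (interchange (f x) (g x) _ _)

    ΣL-neg : ∀ (f : A → Carrier) (xs : List A) → ΣL (map (λ x → - f x) xs) ≈ - ΣL (map f xs)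
    ΣL-neg f [] = sym (+-AbelianGroup.ε⁻¹≈ε)
    ΣL-neg f (x ∷ xs) = trans (+-congˡ (ΣL-neg f xs)) (+-AbelianGroup.⁻¹-∙-comm (f x) _)

    ΣL-- : ∀ (f g : A → Carrier) (xs : List A) → ΣL (map (λ x → f x - g x) xs) ≈ ΣL (map f xs) - ΣL (map g xs)
    ΣL-- f g xs = trans (ΣL-+ f (λ x → - g x) xs) (+-congˡ (ΣL-neg g xs))

    ΣL-*ˡ : ∀ a (f : A → Carrier) (xs : List A) → a * ΣL (map f xs) ≈ ΣL (map (λ x → a * f x) xs)
    ΣL-*ˡ a f [] = zeroʳ a
    ΣL-*ˡ a f (x ∷ xs) = trans (distribˡ a (f x) _) (+-congˡ (ΣL-*ˡ a f xs))

    ΣL-*ʳ : ∀ a (f : A → Carrier) (xs : List A) → ΣL (map f xs) * a ≈ ΣL (map (λ x → f x * a) xs)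
    ΣL-*ʳ a f [] = zeroˡ a
    ΣL-*ʳ a f (x ∷ xs) = trans (distribʳ a (f x) _) (+-congˡ (ΣL-*ʳ a f xs))

    ΣL-↭ : ∀ (f : A → Carrier) {xs ys : List A} → xs ↭ ys → ΣL (map f xs) ≈ ΣL (map f ys)
    ΣL-↭ f p = PS.foldr-commMonoid setoid +-isCommutativeMonoid (↭⇒↭ₛ′ isEquivalence (PP.map⁺ f p))

    ΣL-partition : ∀ {p} {P : Pred A p} (P? : Decidable P) (f : A → Carrier) (xs : List A) →
      ΣL (map f xs) ≈ ΣL (map f (filter P? xs)) + ΣL (map f (filter (λ x → ¬? (P? x)) xs))
    ΣL-partition P? f [] = sym (+-identityˡ 0#)
    ΣL-partition P? f (x ∷ xs) with P? x
    ... | yes _ = trans (+-congˡ (ΣL-partition P? f xs)) (sym (+-assoc _ _ _))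
    ... | no _ = trans (+-congˡ (ΣL-partition P? f xs))
                   (trans (sym (+-assoc _ _ _)) (trans (+-congʳ (+-comm _ _)) (+-assoc _ _ _)))

  module _ {A B : Set} where
    ΣL-map : ∀ (f : B → Carrier) (g : A → B) (xs : List A) → ΣL (map f (map g xs)) ≡ ΣL (map (λ x → f (g x)) xs)
    ΣL-map f g xs = ≡.cong ΣL (≡.sym (LP.map-∘ xs))

    ΣL-concatMap : ∀ (f : B → Carrier) (g : A → List B) (xs : List A) →
      ΣL (map f (concatMap g xs)) ≈ ΣL (map (λ x → ΣL (map f (g x))) xs)
    ΣL-concatMap f g [] = refl
    ΣL-concatMap f g (x ∷ xs) = trans (ΣL-map-++ f (g x) (concatMap g xs)) (+-congˡ (ΣL-concatMap f g xs))

    ΣL-swap : ∀ (f : A → B → Carrier) (xs : List A) (ys : List B) →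
      ΣL (map (λ x → ΣL (map (f x) ys)) xs) ≈ ΣL (map (λ y → ΣL (map (λ x → f x y) xs)) ys)
    ΣL-swap f [] ys = sym (ΣL-zero ys (λ _ → refl))
    ΣL-swap f (x ∷ xs) ys = trans (+-congˡ (ΣL-swap f xs ys)) (sym (ΣL-+ (f x) (λ y → ΣL (map (λ x' → f x' y) xs)) ys))

  ·ℕ-+ : ∀ m n a → (m +ℕ n) ·ℕ a ≈ m ·ℕ a + n ·ℕ a
  ·ℕ-+ zero n a = sym (+-identityˡ _)
  ·ℕ-+ (suc m) n a = trans (+-congˡ (·ℕ-+ m n a)) (sym (+-assoc a _ _))

  ·ℕ-Σ : ∀ {A : Set} (g : A → ℕ) (xs : List A) a → (foldr _+ℕ_ 0 (map g xs)) ·ℕ a ≈ ΣL (map (λ x → g x ·ℕ a) xs)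
  ·ℕ-Σ g [] a = refl
  ·ℕ-Σ g (x ∷ xs) a = trans (·ℕ-+ (g x) _ a) (+-congˡ (·ℕ-Σ g xs a))


module CoefficientExpansion {c ℓ : Level} (K : CommutativeRing c ℓ) (N : ℕ) .{{_ : NonZero N}} where

  open ZMod N
  open Series K
  open CommutativeRing K
  open RingSums K
  open Monomials
  open PartialSums
  open Expansion N
  open ListProperties using (map-proj₂-toList-zip)
  open import Data.Nat using (ℕ; zero; suc; _∸_) renaming (_+_ to _+ℕ_)
  open import Data.Nat.Properties using (suc-injective)
  open import Data.Fin using (Fin)
  open import Data.Product using (_×_; _,_; proj₂)
  open import Data.List using (List; []; _∷_; _++_; map; foldr; replicate; upTo)
  import Data.List.Properties as LP
  open import Data.Vec using (Vec; []; _∷_; toList; lookup; _[_]≔_; zip; zipWith; allFin)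
  open import Relation.Binary.PropositionalEquality as ≡ using (_≡_)
  open import Relation.Binary.Reasoning.Setoid setoid

  partialSumProduct : ∀ {n k} → List (Fin n) → Vec (ZN × Fin n) k → Vec ℕ k → NPoly n
  partialSumProduct S c m = foldr _*ᴾ_ (zeroMono ∷ []) (partialSumPowers S (map proj₂ (toList c)) (toList m))

  module _ {n k : ℕ} (S : List (Fin n)) (c : Vec (ZN × Fin n) k) (e : Mono n) (h : LWord → Carrier) where
    weightedTerm : ℕ → Vec ℕ k → Carrier
    weightedTerm j m = coeffᴾ ((map unitMono S ^ᴾ j) *ᴾ partialSumProduct S c m) e ·ℕ h (replicate j x ++ wordOf (toList c) (toList m))

    termsWithLeadingX : ℕ → ℕ → Carrier
    termsWithLeadingX d j = ΣL (map (weightedTerm j) (comps k (d ∸ j)))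

    coefficientSum : ℕ → Carrier
    coefficientSum d = ΣL (map (termsWithLeadingX d) (upTo (suc d)))

  mutual
    coefficientSum≈expansion : ∀ {n k} (S : List (Fin n)) (c : Vec (ZN × Fin n) k) d e (h : LWord → Carrier) →
      degree e ≡ d → coefficientSum S c e h d ≈ ΣL (map h (expansion S (toList c) d e))
    coefficientSum≈expansion S c d e h deg = begin
      coefficientSum S c e h d
        ≈⟨ +-congˡ (reflexive (≡.cong ΣL (≡.trans (LP.map-applyUpTo suc φ d) (≡.sym (LP.map-applyUpTo (λ j → j) (λ j → φ (suc j)) d))))) ⟩
      φ 0 + ΣL (map (λ j → φ (suc j)) (upTo d))
        ≈⟨ +-cong (termsWithLeadingX-zero S c d e h deg) (termsWithLeadingX-suc S c d e h deg) ⟩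
      (ΣL (map h Y) + ΣL (map h E)) + ΣL (map h X)
        ≈⟨ +-comm _ _ ⟩
      ΣL (map h X) + (ΣL (map h Y) + ΣL (map h E))
        ≈⟨ sym (trans (ΣL-map-++ h X (Y ++ E)) (+-congˡ (ΣL-map-++ h Y E))) ⟩
      ΣL (map h (X ++ Y ++ E))
        ≈⟨ reflexive (≡.cong (λ z → ΣL (map h z)) (≡.sym (expansion-unfold S (toList c) d e))) ⟩
      ΣL (map h (expansion S (toList c) d e)) ∎
      where
        φ = termsWithLeadingX S c e h d
        X = xStep expansion S (toList c) d e
        Y = yStep expansion S (toList c) d e
        E = endStep (toList c) d

    termsWithLeadingX-zero : ∀ {n k} (S : List (Fin n)) (c : Vec (ZN × Fin n) k) d e (h : LWord → Carrier) →
      degree e ≡ d →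
      termsWithLeadingX S c e h d 0 ≈ ΣL (map h (yStep expansion S (toList c) d e)) + ΣL (map h (endStep (toList c) d))
    termsWithLeadingX-zero S [] zero e h deg = begin
      coeffᴾ ((zeroMono ∷ []) *ᴾ (zeroMono ∷ [])) e ·ℕ h [] + 0#
        ≈⟨ +-congʳ (reflexive (≡.cong (_·ℕ h []) (≡.trans (≡.cong (λ Q → coeffᴾ Q e) (*ᴾ-identityˡ (zeroMono ∷ []))) (coeffᴾ-one e deg)))) ⟩
      (h [] + 0#) + 0#
        ≈⟨ +-comm _ _ ⟩
      0# + (h [] + 0#) ∎
    termsWithLeadingX-zero S [] (suc d) e h deg = sym (+-identityˡ 0#)
    termsWithLeadingX-zero S ((a , l) ∷ c) d e h deg = begin
      ΣL (map (weightedTerm S ((a , l) ∷ c) e h 0) (comps _ d))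
        ≈⟨ ΣL-concatMap (weightedTerm S ((a , l) ∷ c) e h 0) (λ j → map (j ∷_) (comps _ (d ∸ j))) (upTo (suc d)) ⟩
      ΣL (map (λ j → ΣL (map (weightedTerm S ((a , l) ∷ c) e h 0) (map (j ∷_) (comps _ (d ∸ j))))) (upTo (suc d)))
        ≈⟨ ΣL-cong (upTo (suc d)) (λ j → trans (reflexive (ΣL-map (weightedTerm S ((a , l) ∷ c) e h 0) (j ∷_) (comps _ (d ∸ j))))
             (ΣL-cong (comps _ (d ∸ j)) (λ m → reflexive (≡.cong (_·ℕ h (wordOf (toList ((a , l) ∷ c)) (toList (j ∷ m))))
               (≡.cong (λ Q → coeffᴾ Q e) (*ᴾ-identityˡ (partialSumProduct S ((a , l) ∷ c) (j ∷ m)))))))) ⟩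
      coefficientSum (S ++ l ∷ []) c e (λ w → h (y a ∷ w)) d
        ≈⟨ coefficientSum≈expansion (S ++ l ∷ []) c d e (λ w → h (y a ∷ w)) deg ⟩
      ΣL (map (λ w → h (y a ∷ w)) (expansion (S ++ l ∷ []) (toList c) d e))
        ≈⟨ reflexive (≡.sym (ΣL-map h (y a ∷_) (expansion (S ++ l ∷ []) (toList c) d e))) ⟩
      ΣL (map h (yStep expansion S (toList ((a , l) ∷ c)) d e))
        ≈⟨ sym (+-identityʳ _) ⟩
      ΣL (map h (yStep expansion S (toList ((a , l) ∷ c)) d e)) + ΣL (map h (endStep (toList ((a , l) ∷ c)) d)) ∎

    termsWithLeadingX-suc : ∀ {n k} (S : List (Fin n)) (c : Vec (ZN × Fin n) k) d e (h : LWord → Carrier) →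
      degree e ≡ d →
      ΣL (map (λ j → termsWithLeadingX S c e h d (suc j)) (upTo d)) ≈ ΣL (map h (xStep expansion S (toList c) d e))
    termsWithLeadingX-suc S c zero e h deg = refl
    termsWithLeadingX-suc {n} {k} S c (suc d) e h deg = begin
      ΣL (map (λ j → ΣL (map (weightedTerm S c e h (suc j)) (comps k (d ∸ j)))) (upTo (suc d)))
        ≈⟨ ΣL-cong (upTo (suc d)) (λ j → ΣL-cong (comps k (d ∸ j)) (λ m → first-x-by-variable j m)) ⟩
      ΣL (map (λ j → ΣL (map (λ m → ΣL (map (λ l → lowered l j m) S)) (comps k (d ∸ j)))) (upTo (suc d)))
        ≈⟨ ΣL-cong (upTo (suc d)) (λ j → ΣL-swap (λ m l → lowered l j m) (comps k (d ∸ j)) S) ⟩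
      ΣL (map (λ j → ΣL (map (λ l → ΣL (map (lowered l j) (comps k (d ∸ j)))) S)) (upTo (suc d)))
        ≈⟨ ΣL-swap (λ j l → ΣL (map (lowered l j) (comps k (d ∸ j)))) (upTo (suc d)) S ⟩
      ΣL (map (λ l → ΣL (map (λ j → ΣL (map (lowered l j) (comps k (d ∸ j)))) (upTo (suc d)))) S)
        ≈⟨ ΣL-cong S (λ l → per-variable l (lookup e l) ≡.refl) ⟩
      ΣL (map (λ l → ΣL (map h (xStepAt expansion S (toList c) d e l (lookup e l)))) S)
        ≈⟨ sym (ΣL-concatMap h (λ l → xStepAt expansion S (toList c) d e l (lookup e l)) S) ⟩
      ΣL (map h (xStep expansion S (toList c) (suc d) e)) ∎
      where
        after-first-x : ℕ → Vec ℕ k → NPoly n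
        after-first-x j m = (map unitMono S ^ᴾ j) *ᴾ partialSumProduct S c m
        word : ℕ → Vec ℕ k → LWord
        word j m = replicate (suc j) x ++ wordOf (toList c) (toList m)
        lowered : Fin n → ℕ → Vec ℕ k → Carrier
        lowered l j m = coeffᴾ-lowered e l (lookup e l) (after-first-x j m) ·ℕ h (word j m)

        first-x-by-variable : ∀ j m → weightedTerm S c e h (suc j) m ≈ ΣL (map (λ l → lowered l j m) S)
        first-x-by-variable j m = trans (reflexive (≡.cong (_·ℕ h (word j m))
            (≡.trans (≡.cong (λ z → coeffᴾ z e) (*ᴾ-assoc (map unitMono S) (map unitMono S ^ᴾ j) (partialSumProduct S c m)))
            (≡.trans (≡.cong (λ z → coeffᴾ z e) (LP.concatMap-map (λ m₁ → map (zipWith _+ℕ_ m₁) (after-first-x j m)) unitMono S))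
            (≡.trans (coeffᴾ-concatMap (λ l → map (zipWith _+ℕ_ (unitMono l)) (after-first-x j m)) S e)
                     (≡.cong (foldr _+ℕ_ 0) (LP.map-cong (λ l → coeffᴾ-shift-unitMono e l (after-first-x j m)) S)))))))
            (·ℕ-Σ (λ l → coeffᴾ-lowered e l (lookup e l) (after-first-x j m)) S (h (word j m)))

        per-variable : ∀ l k' → lookup e l ≡ k' →
          ΣL (map (λ j → ΣL (map (λ m → coeffᴾ-lowered e l k' (after-first-x j m) ·ℕ h (word j m)) (comps k (d ∸ j)))) (upTo (suc d)))
          ≈ ΣL (map h (xStepAt expansion S (toList c) d e l k'))
        per-variable l zero eq = ΣL-zero (upTo (suc d)) (λ j → ΣL-zero (comps k (d ∸ j)) (λ _ → refl))
        per-variable l (suc k') eq =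
          trans (coefficientSum≈expansion S c d (e [ l ]≔ k') (λ w → h (x ∷ w)) (suc-injective (≡.trans (degree-decrement e l k' eq) deg)))
                (reflexive (≡.sym (ΣL-map h (x ∷_) (expansion S (toList c) d (e [ l ]≔ k')))))

  yMonomial≡partialSumProduct : ∀ {n} (a : Vec ZN n) (m : Vec ℕ n) → yMonomial m ≡ partialSumProduct [] (zip a (allFin n)) m
  yMonomial≡partialSumProduct {n} a m = ≡.cong (foldr _*ᴾ_ (zeroMono ∷ []))
    (≡.trans (yForm-powers m) (≡.cong (λ z → partialSumPowers [] z (toList m)) (≡.sym (map-proj₂-toList-zip a (allFin n)))))

  Σcoeff≈Σexpansion : ∀ {n} (a : Vec ZN n) (e : Mono n) (h : LWord → Carrier) →
    ΣL (map (λ m → coeffᴾ (yMonomial m) e ·ℕ h (wordOf (lettersOf a) (toList m))) (comps n (degree e)))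
    ≈ ΣL (map h (expansion [] (lettersOf a) (degree e) e))
  Σcoeff≈Σexpansion {n} a e h = begin
    ΣL (map (λ m → coeffᴾ (yMonomial m) e ·ℕ h (wordOf (lettersOf a) (toList m))) (comps n d))
      ≈⟨ ΣL-cong (comps n d) (λ m → reflexive (≡.cong (λ z → coeffᴾ z e ·ℕ h (wordOf (lettersOf a) (toList m)))
            (≡.trans (yMonomial≡partialSumProduct a m) (≡.sym (*ᴾ-identityˡ (partialSumProduct [] c₀ m)))))) ⟩
    φ 0
      ≈⟨ sym (+-identityʳ _) ⟩
    φ 0 + 0#
      ≈⟨ +-congˡ (sym (ΣL-zero (upTo d) (λ j → ΣL-zero (comps n (d ∸ suc j)) (λ _ → refl)))) ⟩
    φ 0 + ΣL (map (λ j → φ (suc j)) (upTo d))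
      ≈⟨ +-congˡ (reflexive (≡.cong ΣL (≡.sym (≡.trans (LP.map-applyUpTo suc φ d) (≡.sym (LP.map-applyUpTo (λ j → j) (λ j → φ (suc j)) d)))))) ⟩
    coefficientSum [] c₀ e h d
      ≈⟨ coefficientSum≈expansion [] c₀ d e h ≡.refl ⟩
    ΣL (map h (expansion [] (lettersOf a) d e)) ∎
    where
      d = degree e
      c₀ = zip a (allFin n)
      φ = termsWithLeadingX [] c₀ e h d


module LeadingWord (N : ℕ) .{{_ : NonZero N}} where

  open ZMod N
  open ListProperties
  open SumOver
  open Expansion N
  open import Data.Nat using (ℕ; zero; suc; _+_; _*_; _≤_; _<_; z≤n; s≤s; _≟_)
  open import Data.Nat.Properties
  open import Data.Nat.Tactic.RingSolver using (solve-∀)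
  open import Data.Fin using (Fin)
  open import Data.Product using (_×_; _,_; proj₂; Σ)
  open import Data.List using (List; []; _∷_; _++_; map; concatMap; length; replicate; filter)
  import Data.List.Properties as LP
  open import Data.List.Membership.Propositional using (_∈_; _∉_)
  open import Data.List.Relation.Unary.All as All using (All; []; _∷_)
  import Data.List.Relation.Unary.All.Properties as AllP
  open import Data.List.Relation.Unary.Any using (here; there)
  open import Data.List.Relation.Unary.Unique.Propositional using (Unique; _∷_)
  open import Data.Vec using (Vec; lookup; _[_]≔_)
  open import Data.Vec.Properties using (lookup∘update; lookup∘update′)
  open import Relation.Binary.PropositionalEquality using (_≡_; _≢_; refl; sym; trans; cong; cong₂; subst; module ≡-Reasoning)
  open import Relation.Nullary.Decidable using (does-⇔)
  open import Relation.Unary using (Decidable)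
  open import Function.Bundles using (mk⇔)

  yCount : LWord → ℕ
  yCount [] = 0
  yCount (x ∷ u) = yCount u
  yCount (y _ ∷ u) = suc (yCount u)

  -- The number of pairs (x , y) with the x to the left of the y.  Over the words of an expansion it is
  -- maximal exactly at the word with every x as far left as possible.
  inversions : LWord → ℕ
  inversions [] = 0
  inversions (x ∷ u) = yCount u + inversions u
  inversions (y _ ∷ u) = inversions u

  All-concatMap⁺ : ∀ {A B : Set} {P : B → Set} (f : A → List B) (xs : List A) →
    (∀ z → z ∈ xs → All P (f z)) → All P (concatMap f xs)
  All-concatMap⁺ f [] h = []
  All-concatMap⁺ f (z ∷ xs) h = AllP.++⁺ (h z (here refl)) (All-concatMap⁺ f xs (λ z' z'∈ → h z' (there z'∈)))

  shift-* : ∀ s t m r → s * suc m + (t * m + r) ≡ s + ((s + t) * m + r)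
  shift-* = solve-∀

  module _ {n : ℕ} where
    HasShape : Letters n → LWord → Set
    HasShape c u = Σ ℕ λ j → Σ (List ℕ) λ ms → (length ms ≡ length c) × (u ≡ replicate j x ++ wordOf c ms)

    expansion-shape : ∀ (S : List (Fin n)) c d e → All (HasShape c) (expansion S c d e)
    expansion-shape S c d e rewrite expansion-unfold S c d e = AllP.++⁺ (xPart d e) (AllP.++⁺ (yPart c) (endPart c d))
      where
        xPart : ∀ d e → All (HasShape c) (xStep expansion S c d e)
        xPart zero e = []
        xPart (suc d) e = All-concatMap⁺ _ S (λ l _ → atExponent l (lookup e l))
          where atExponent : ∀ l k → All (HasShape c) (xStepAt expansion S c d e l k)
                atExponent l zero = []
                atExponent l (suc k) = AllP.map⁺ (All.map (λ { (j , ms , len , eq) → suc j , ms , len , cong (x ∷_) eq })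
                                                         (expansion-shape S c d (e [ l ]≔ k)))
        yPart : ∀ c → All (HasShape c) (yStep expansion S c d e)
        yPart [] = []
        yPart ((a , l) ∷ c) = AllP.map⁺ (All.map (λ { (j , ms , len , eq) → 0 , j ∷ ms , cong suc len , cong (y a ∷_) eq })
                                                (expansion-shape (S ++ l ∷ []) c d e))
        endPart : ∀ c d → All (HasShape c) (endStep c d)
        endPart [] zero = (0 , [] , refl , refl) ∷ []
        endPart [] (suc d) = []
        endPart (_ ∷ _) d = []

    yCount-xPower : ∀ j w → yCount (replicate j x ++ w) ≡ yCount w
    yCount-xPower zero w = refl
    yCount-xPower (suc j) w = yCount-xPower j w

    yCount-wordOf : ∀ (c : Letters n) ms → length ms ≡ length c → yCount (wordOf c ms) ≡ length c
    yCount-wordOf [] [] eq = refl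
    yCount-wordOf ((a , l) ∷ c) (k ∷ ms) eq = cong suc (trans (yCount-xPower k (wordOf c ms)) (yCount-wordOf c ms (suc-injective eq)))

    yCount-shape : ∀ (c : Letters n) u → HasShape c u → yCount u ≡ length c
    yCount-shape c u (j , ms , len , refl) = trans (yCount-xPower j (wordOf c ms)) (yCount-wordOf c ms len)

    canonicalWord : Letters n → Vec ℕ n → LWord
    canonicalWord c e = wordOf c (map (λ p → lookup e (proj₂ p)) c)

    canonicalWord-update : ∀ (c : Letters n) e l k → l ∉ map proj₂ c → canonicalWord c (e [ l ]≔ k) ≡ canonicalWord c e
    canonicalWord-update c e l k l∉c = cong (wordOf c) (LP.map-cong-local (unchanged c l∉c))
      where unchanged : ∀ (c : Letters n) → l ∉ map proj₂ c → All (λ p → lookup (e [ l ]≔ k) (proj₂ p) ≡ lookup e (proj₂ p)) c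
            unchanged [] _ = []
            unchanged ((a , l') ∷ c) l∉ = lookup∘update′ (λ l'≡l → l∉ (here (sym l'≡l))) e k ∷ unchanged c (λ z → l∉ (there z))

    canonicalInversions : Letters n → Vec ℕ n → ℕ
    canonicalInversions [] e = 0
    canonicalInversions ((a , l) ∷ c) e = lookup e l * length c + canonicalInversions c e

    canonicalInversions-mono : ∀ (c : Letters n) (e e' : Vec ℕ n) → (∀ j → lookup e' j ≤ lookup e j) →
      canonicalInversions c e' ≤ canonicalInversions c e
    canonicalInversions-mono [] e e' h = z≤n
    canonicalInversions-mono ((a , l) ∷ c) e e' h = +-mono-≤ (*-monoˡ-≤ (length c) (h l)) (canonicalInversions-mono c e e' h)

    canonicalInversions-update : ∀ (c : Letters n) e l k → l ∉ map proj₂ c →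
      canonicalInversions c (e [ l ]≔ k) ≡ canonicalInversions c e
    canonicalInversions-update [] e l k h = refl
    canonicalInversions-update ((a , l') ∷ c) e l k h =
      cong₂ _+_ (cong (_* length c) (lookup∘update′ (λ eq → h (here (sym eq))) e k)) (canonicalInversions-update c e l k (λ z → h (there z)))

    inversionBound : List (Fin n) → Letters n → Vec ℕ n → ℕ
    inversionBound S c e = sumOver S e * length c + canonicalInversions c e

    inversionBound-xStep : ∀ S (c : Letters n) e l k → l ∈ S → lookup e l ≡ suc k →
      length c + inversionBound S c (e [ l ]≔ k) ≤ inversionBound S c e
    inversionBound-xStep S c e l k l∈S e[l]≡1+k =
      ≤-trans (≤-reflexive (sym (+-assoc (length c) _ _)))
              (+-mono-≤ (*-monoˡ-≤ (length c) (sumOver-decrement-< S e l k l∈S e[l]≡1+k))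
                        (canonicalInversions-mono c e (e [ l ]≔ k) (λ j → lookup-decrement-≤ e l k j e[l]≡1+k)))

    inversionBound-yStep : ∀ S a l (c : Letters n) e →
      sumOver S e + inversionBound (S ++ l ∷ []) c e ≡ inversionBound S ((a , l) ∷ c) e
    inversionBound-yStep S a l c e =
      trans (cong (λ s → sumOver S e + (s * length c + canonicalInversions c e))
                  (trans (sumOver-++ S (l ∷ []) e) (cong (sumOver S e +_) (+-identityʳ (lookup e l)))))
            (sym (shift-* (sumOver S e) (lookup e l) (length c) (canonicalInversions c e)))

    expansion-inversions≤ : ∀ (S : List (Fin n)) c d e → All (λ u → inversions u ≤ inversionBound S c e) (expansion S c d e)
    expansion-inversions≤ S c d e rewrite expansion-unfold S c d e = AllP.++⁺ (xPart d e) (AllP.++⁺ (yPart c) (endPart c d))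
      where
        xPart : ∀ d e → All (λ u → inversions u ≤ inversionBound S c e) (xStep expansion S c d e)
        xPart zero e = []
        xPart (suc d) e = All-concatMap⁺ _ S (λ l l∈ → atExponent l l∈ (lookup e l) refl)
          where
            atExponent : ∀ l → l ∈ S → ∀ k → lookup e l ≡ k →
              All (λ u → inversions u ≤ inversionBound S c e) (xStepAt expansion S c d e l k)
            atExponent l l∈ zero eq = []
            atExponent l l∈ (suc k) eq = AllP.map⁺ (All.map bound
              (All.zip (expansion-shape S c d (e [ l ]≔ k) , expansion-inversions≤ S c d (e [ l ]≔ k))))
              where
                bound : ∀ {u} → HasShape c u × (inversions u ≤ inversionBound S c (e [ l ]≔ k)) →
                        yCount u + inversions u ≤ inversionBound S c e
                bound {u} (sh , b) rewrite yCount-shape c u sh =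
                  ≤-trans (+-monoʳ-≤ (length c) b) (inversionBound-xStep S c e l k l∈ eq)
        yPart : ∀ c → All (λ u → inversions u ≤ inversionBound S c e) (yStep expansion S c d e)
        yPart [] = []
        yPart ((a , l) ∷ c) = AllP.map⁺ (All.map
          (λ {u} b → ≤-trans b (subst (inversionBound (S ++ l ∷ []) c e ≤_) (inversionBound-yStep S a l c e) (m≤n+m _ (sumOver S e))))
          (expansion-inversions≤ (S ++ l ∷ []) c d e))
        endPart : ∀ c d → All (λ u → inversions u ≤ inversionBound S c e) (endStep c d)
        endPart [] zero = z≤n ∷ []
        endPart [] (suc d) = []
        endPart (_ ∷ _) d = []

    xStep-exhausted : ∀ (S : List (Fin n)) c d e → All (λ l → lookup e l ≡ 0) S → xStep expansion S c d e ≡ []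
    xStep-exhausted S c zero e z = refl
    xStep-exhausted S c (suc d) e z = concatMap-[]-∈ (λ l → xStepAt expansion S c d e l (lookup e l)) S
                                        (λ l l∈ → cong (xStepAt expansion S c d e l) (All.lookup z l∈))

    -- Holds at the start of every expansion of F# and is preserved along its canonical word.
    record Canonical (S₀ : List (Fin n)) (cur : Fin n) (c : Letters n) (d : ℕ) (e : Vec ℕ n) (k₀ : ℕ) : Set where
      field
        cur-exponent : lookup e cur ≡ k₀
        used-up : All (λ l → lookup e l ≡ 0) S₀
        cur-fresh : cur ∉ map proj₂ c
        pending-unique : Unique (map proj₂ c)
        degree-exact : d ≡ k₀ + sumOver (map proj₂ c) e

    maxInversions : Letters n → Vec ℕ n → ℕ → ℕ
    maxInversions c e k₀ = k₀ * length c + canonicalInversions c e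

    open Canonical

    sumOver-canonical : ∀ {S₀ cur c d e k₀} → Canonical S₀ cur c d e k₀ → sumOver (S₀ ++ cur ∷ []) e ≡ k₀
    sumOver-canonical {S₀} {cur} {e = e} can =
      trans (sumOver-++ S₀ (cur ∷ []) e)
            (cong₂ _+_ (sumOver-zero e S₀ (used-up can)) (trans (+-identityʳ (lookup e cur)) (cur-exponent can)))

    canonical-xStep : ∀ {S₀ cur c d e k} → Canonical S₀ cur c (suc d) e (suc k) → Canonical S₀ cur c d (e [ cur ]≔ k) k
    canonical-xStep {S₀} {cur} {c} {d} {e} {k} can = record
      { cur-exponent = lookup∘update cur e k
      ; used-up = All.map still-zero (used-up can)
      ; cur-fresh = cur-fresh can
      ; pending-unique = pending-unique can
      ; degree-exact = trans (suc-injective (degree-exact can)) (cong (k +_) (sym (sumOver-update (map proj₂ c) e cur k (cur-fresh can))))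
      }
      where
        still-zero : ∀ {l} → lookup e l ≡ 0 → lookup (e [ cur ]≔ k) l ≡ 0
        still-zero {l} e[l]≡0 = trans (lookup∘update′ l≢cur e k) e[l]≡0
          where l≢cur : l ≢ cur
                l≢cur l≡cur with () ← trans (sym e[l]≡0) (trans (cong (lookup e) l≡cur) (cur-exponent can))

    canonical-yStep : ∀ {S₀ cur a l c d e} → Canonical S₀ cur ((a , l) ∷ c) d e 0 →
      Canonical (S₀ ++ cur ∷ []) l c d e (lookup e l)
    canonical-yStep can with pending-unique can
    ... | l-fresh ∷ unique = record
      { cur-exponent = refl
      ; used-up = AllP.++⁺ (used-up can) (cur-exponent can ∷ [])
      ; cur-fresh = λ l∈ → All.lookup l-fresh l∈ refl
      ; pending-unique = unique
      ; degree-exact = degree-exact can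
      }

    endStep-suc : ∀ (c : Letters n) d → endStep c (suc d) ≡ []
    endStep-suc [] d = refl
    endStep-suc (_ ∷ _) d = refl

    filter-expansion : ∀ {p} {P : LWord → Set p} (P? : Decidable P) S (c : Letters n) d e →
      filter P? (expansion S c d e)
        ≡ filter P? (xStep expansion S c d e) ++ filter P? (yStep expansion S c d e) ++ filter P? (endStep c d)
    filter-expansion P? S c d e =
      trans (cong (filter P?) (expansion-unfold S c d e))
            (trans (LP.filter-++ P? (xStep expansion S c d e) (yStep expansion S c d e ++ endStep c d))
                   (cong (filter P? (xStep expansion S c d e) ++_) (LP.filter-++ P? (yStep expansion S c d e) (endStep c d))))

    filter-yStep-maxInversions : ∀ S₀ cur c d e k → Canonical S₀ cur c d e (suc k) →
      filter (λ u → inversions u ≟ maxInversions c e (suc k)) (yStep expansion (S₀ ++ cur ∷ []) c d e) ≡ []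
    filter-yStep-maxInversions S₀ cur [] d e k can = refl
    filter-yStep-maxInversions S₀ cur ((a , l) ∷ c) d e k can =
      LP.filter-none _ (AllP.map⁺ (All.map (λ b → <⇒≢ (≤-<-trans b below-max)) (expansion-inversions≤ (S ++ l ∷ []) c d e)))
      where
        S = S₀ ++ cur ∷ []
        bound = inversionBound (S ++ l ∷ []) c e
        below-max : bound < maxInversions ((a , l) ∷ c) e (suc k)
        below-max = subst (λ s → bound < s * suc (length c) + canonicalInversions ((a , l) ∷ c) e) (sumOver-canonical can)
                      (subst (bound <_) (inversionBound-yStep S a l c e)
                             (m<n+m bound (subst (0 <_) (sym (sumOver-canonical can)) (s≤s z≤n))))

    filter-xStep-maxInversions : ∀ S₀ cur c d e k → Canonical S₀ cur c (suc d) e (suc k) → ∀ {w} →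
      filter (λ u → inversions u ≟ maxInversions c (e [ cur ]≔ k) k) (expansion (S₀ ++ cur ∷ []) c d (e [ cur ]≔ k)) ≡ w ∷ [] →
      filter (λ u → inversions u ≟ maxInversions c e (suc k)) (xStep expansion (S₀ ++ cur ∷ []) c (suc d) e) ≡ (x ∷ w) ∷ []
    filter-xStep-maxInversions S₀ cur c d e k can {w} ih = begin
      filter P? (concatMap at (S₀ ++ cur ∷ []))
        ≡⟨ cong (filter P?) (LP.concatMap-++ at S₀ (cur ∷ [])) ⟩
      filter P? (concatMap at S₀ ++ at cur ++ [])
        ≡⟨ cong (λ z → filter P? (z ++ at cur ++ []))
                (concatMap-[]-∈ at S₀ (λ l l∈ → cong (xStepAt expansion S c d e l) (All.lookup (used-up can) l∈))) ⟩
      filter P? (at cur ++ [])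
        ≡⟨ cong (λ z → filter P? (xStepAt expansion S c d e cur z ++ [])) (cur-exponent can) ⟩
      filter P? (map (x ∷_) (expansion S c d e') ++ [])
        ≡⟨ cong (filter P?) (LP.++-identityʳ (map (x ∷_) (expansion S c d e'))) ⟩
      filter P? (map (x ∷_) (expansion S c d e'))
        ≡⟨ filter-map-comm P? P'? (x ∷_) (All.map (λ {u} sh → does-⇔ (mk⇔ (fwd u sh) (bwd u sh)) (P? (x ∷ u)) (P'? u)) (expansion-shape S c d e')) ⟩
      map (x ∷_) (filter P'? (expansion S c d e'))
        ≡⟨ cong (map (x ∷_)) ih ⟩
      (x ∷ w) ∷ [] ∎
      where
        open ≡-Reasoning
        S = S₀ ++ cur ∷ []
        e' = e [ cur ]≔ k
        at = λ l → xStepAt expansion S c d e l (lookup e l)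
        P? = λ u → inversions u ≟ maxInversions c e (suc k)
        P'? = λ u → inversions u ≟ maxInversions c e' k
        fwd : ∀ u → HasShape c u → yCount u + inversions u ≡ maxInversions c e (suc k) → inversions u ≡ maxInversions c e' k
        fwd u sh h rewrite yCount-shape c u sh | canonicalInversions-update c e cur k (cur-fresh can) =
          +-cancelˡ-≡ (length c) _ _ (trans h (+-assoc (length c) (k * length c) (canonicalInversions c e)))
        bwd : ∀ u → HasShape c u → inversions u ≡ maxInversions c e' k → yCount u + inversions u ≡ maxInversions c e (suc k)
        bwd u sh h rewrite yCount-shape c u sh | canonicalInversions-update c e cur k (cur-fresh can) | h =
          sym (+-assoc (length c) (k * length c) (canonicalInversions c e))

    expansion-maxInversions : ∀ S₀ cur c d e k₀ → Canonical S₀ cur c d e k₀ →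
      filter (λ u → inversions u ≟ maxInversions c e k₀) (expansion (S₀ ++ cur ∷ []) c d e)
        ≡ (replicate k₀ x ++ canonicalWord c e) ∷ []
    expansion-maxInversions S₀ cur c zero e (suc k) can with () ← degree-exact can
    expansion-maxInversions S₀ cur c (suc d) e (suc k) can = begin
      filter P? (expansion S c (suc d) e)
        ≡⟨ filter-expansion P? S c (suc d) e ⟩
      filter P? (xStep expansion S c (suc d) e) ++ filter P? (yStep expansion S c (suc d) e) ++ filter P? (endStep c (suc d))
        ≡⟨ cong₂ _++_ (filter-xStep-maxInversions S₀ cur c d e k can
                          (expansion-maxInversions S₀ cur c d (e [ cur ]≔ k) k (canonical-xStep can)))
                      (cong₂ _++_ (filter-yStep-maxInversions S₀ cur c (suc d) e k can) (cong (filter P?) (endStep-suc c d))) ⟩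
      (x ∷ replicate k x ++ canonicalWord c (e [ cur ]≔ k)) ∷ []
        ≡⟨ cong (λ w → (x ∷ replicate k x ++ w) ∷ []) (canonicalWord-update c e cur k (cur-fresh can)) ⟩
      (replicate (suc k) x ++ canonicalWord c e) ∷ [] ∎
      where
        open ≡-Reasoning
        S = S₀ ++ cur ∷ []
        P? = λ u → inversions u ≟ maxInversions c e (suc k)
    expansion-maxInversions S₀ cur [] d e zero can rewrite degree-exact can | expansion-unfold (S₀ ++ cur ∷ []) [] 0 e = refl
    expansion-maxInversions S₀ cur ((a , l) ∷ c) d e zero can = begin
      filter P? (expansion S ((a , l) ∷ c) d e)
        ≡⟨ filter-expansion P? S ((a , l) ∷ c) d e ⟩
      filter P? (xStep expansion S ((a , l) ∷ c) d e) ++ filter P? (yStep expansion S ((a , l) ∷ c) d e) ++ []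
        ≡⟨ cong (λ z → filter P? z ++ filter P? (yStep expansion S ((a , l) ∷ c) d e) ++ [])
                (xStep-exhausted S ((a , l) ∷ c) d e (AllP.++⁺ (used-up can) (cur-exponent can ∷ []))) ⟩
      filter P? (map (y a ∷_) (expansion (S ++ l ∷ []) c d e)) ++ []
        ≡⟨ LP.++-identityʳ _ ⟩
      filter P? (map (y a ∷_) (expansion (S ++ l ∷ []) c d e))
        ≡⟨ filter-map-comm P? P? (y a ∷_) (All.universal (λ _ → refl) (expansion (S ++ l ∷ []) c d e)) ⟩
      map (y a ∷_) (filter P? (expansion (S ++ l ∷ []) c d e))
        ≡⟨ cong (map (y a ∷_)) (expansion-maxInversions S l c d e (lookup e l) (canonical-yStep can)) ⟩
      (y a ∷ replicate (lookup e l) x ++ canonicalWord c e) ∷ [] ∎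
      where
        open ≡-Reasoning
        S = S₀ ++ cur ∷ []
        P? = λ u → inversions u ≟ maxInversions c e (lookup e l)


module Relabelling (N : ℕ) .{{_ : NonZero N}} where

  open ZMod N
  open SumOver using (finList)
  open Expansion N
  open ShuffleOfExpansions N using (interleavings; liftˡ; liftʳ)
  open Monomials using (lookup-ext)
  open import Data.Nat using (ℕ; zero; suc; _<_)
  open import Data.Nat.Properties using (<-irrefl; m≤m+n; <-≤-trans; +-suc)
  open import Data.Fin using (Fin; toℕ; _↑ˡ_; _↑ʳ_) renaming (zero to fzero; suc to fsuc; _≟_ to _≟ᶠ_)
  import Data.Fin.Properties as FP
  open import Data.Product using (_×_; _,_; map₂)
  open import Data.List using (List; []; _∷_; _++_; map)
  import Data.List.Properties as LP
  open import Data.List.Membership.Propositional.Properties using (∈-map⁻)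
  open import Data.List.Relation.Binary.Disjoint.Propositional using (Disjoint)
  open import Data.List.Relation.Binary.Permutation.Propositional using (_↭_; ↭-refl; ↭-sym; ↭-trans; prep; ↭⇒↭ₛ)
  import Data.List.Relation.Binary.Permutation.Propositional.Properties as PP
  import Data.List.Relation.Binary.Permutation.Setoid.Properties as PSP
  open import Data.List.Relation.Unary.All as All using (All; []; _∷_)
  import Data.List.Relation.Unary.All.Properties as AllP
  open import Data.List.Relation.Unary.Unique.Propositional using (Unique; _∷_)
  import Data.List.Relation.Unary.Unique.Propositional.Properties as UP
  open import Data.Vec as V using (Vec; []; _∷_; lookup; _[_]≔_; toList; tabulate)
  import Data.Vec.Properties as VP
  open import Relation.Binary.PropositionalEquality using (_≡_; _≢_; refl; sym; trans; cong; cong₂; subst; setoid)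
  open import Relation.Nullary using (yes; no)

  module _ {n : ℕ} (π : Vec (Fin n) n) (π-injective : ∀ {i j} → lookup π i ≡ lookup π j → i ≡ j) where
    relabelLetter : ZN × Fin n → ZN × Fin n
    relabelLetter = map₂ (lookup π)

    map-lookup-update : ∀ (e : Vec ℕ n) l k → (V.map (lookup e) π) [ l ]≔ k ≡ V.map (lookup (e [ lookup π l ]≔ k)) π
    map-lookup-update e l k = lookup-ext _ _ pointwise
      where pointwise : ∀ j → lookup (V.map (lookup e) π [ l ]≔ k) j ≡ lookup (V.map (lookup (e [ lookup π l ]≔ k)) π) j
            pointwise j rewrite VP.lookup-map j (lookup (e [ lookup π l ]≔ k)) π with j ≟ᶠ l
            ... | yes refl rewrite VP.lookup∘update j (V.map (lookup e) π) k | VP.lookup∘update (lookup π j) e k = refl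
            ... | no j≢l rewrite VP.lookup∘update′ j≢l (V.map (lookup e) π) k
                               | VP.lookup∘update′ (λ eq → j≢l (π-injective eq)) e k = VP.lookup-map j (lookup e) π

    expansion-relabel : ∀ S c d (e : Vec ℕ n) →
      expansion S c d (V.map (lookup e) π) ≡ expansion (map (lookup π) S) (map relabelLetter c) d e
    expansion-relabel S c d e
      rewrite expansion-unfold S c d (V.map (lookup e) π) | expansion-unfold (map (lookup π) S) (map relabelLetter c) d e =
      cong₂ _++_ (xPart d) (cong₂ _++_ (yPart c) (endPart c d))
      where
        E = V.map (lookup e) π
        xPart : ∀ d → xStep expansion S c d E ≡ xStep expansion (map (lookup π) S) (map relabelLetter c) d e
        xPart zero = refl
        xPart (suc d) = trans (LP.concatMap-cong (λ l → trans (cong (xStepAt expansion S c d E l) (VP.lookup-map l (lookup e) π))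
                                                       (atExponent l (lookup e (lookup π l)))) S)
                              (sym (LP.concatMap-map _ (lookup π) S))
          where atExponent : ∀ l k → xStepAt expansion S c d E l k ≡ xStepAt expansion (map (lookup π) S) (map relabelLetter c) d e (lookup π l) k
                atExponent l zero = refl
                atExponent l (suc k) = cong (map (x ∷_)) (trans (cong (expansion S c d) (map-lookup-update e l k))
                                                                (expansion-relabel S c d (e [ lookup π l ]≔ k)))
        yPart : ∀ c → yStep expansion S c d E ≡ yStep expansion (map (lookup π) S) (map relabelLetter c) d e
        yPart [] = refl
        yPart ((a , l) ∷ c) = cong (map (y a ∷_)) (trans (expansion-relabel (S ++ l ∷ []) c d e)
                                (cong (λ S' → expansion S' (map relabelLetter c) d e) (LP.map-++ (lookup π) S (l ∷ []))))
        endPart : ∀ c d → endStep c d ≡ endStep (map relabelLetter c) d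
        endPart [] zero = refl
        endPart [] (suc d) = refl
        endPart (_ ∷ _) d = refl

  interleavings-↭ : ∀ {A : Set} (u v : List A) → All (λ w → w ↭ u ++ v) (interleavings u v)
  interleavings-↭ [] v = ↭-refl ∷ []
  interleavings-↭ (a ∷ u) [] = AllP.map⁺ (All.map (prep a) (interleavings-↭ u []))
  interleavings-↭ (a ∷ u) (b ∷ v) =
    AllP.++⁺ (AllP.map⁺ (All.map (prep a) (interleavings-↭ u (b ∷ v))))
             (AllP.map⁺ (All.map (λ p → ↭-trans (prep b p) (↭-sym (PP.shift b (a ∷ u) v))) (interleavings-↭ (a ∷ u) v)))

  map-toList-interleave : ∀ {A : Set} {r s} (u : Vec A r) (v : Vec A s) →
    map toList (interleave u v) ≡ interleavings (toList u) (toList v)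
  map-toList-interleave [] v = refl
  map-toList-interleave (a ∷ u) [] =
    trans (sym (LP.map-∘ (interleave u []))) (trans (LP.map-∘ (interleave u [])) (cong (map (a ∷_)) (map-toList-interleave u [])))
  map-toList-interleave {r = suc r} {s = suc s} (a ∷ u) (b ∷ v) =
    trans (LP.map-++ toList (map (a ∷_) (interleave u (b ∷ v))) _)
    (cong₂ _++_ (trans (sym (LP.map-∘ (interleave u (b ∷ v))))
                       (trans (LP.map-∘ (interleave u (b ∷ v))) (cong (map (a ∷_)) (map-toList-interleave u (b ∷ v)))))
                (trans (sym (LP.map-∘ (interleave (a ∷ u) v)))
                (trans (LP.map-cong (λ w → VP.toList-cast (sym (+-suc (suc r) s)) (b ∷ w)) (interleave (a ∷ u) v))
                (trans (LP.map-∘ (interleave (a ∷ u) v)) (cong (map (b ∷_)) (map-toList-interleave (a ∷ u) v))))))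

  All-≢⇒≢-lookup : ∀ {A : Set} {n} {a : A} (π : Vec A n) → All (a ≢_) (toList π) → ∀ j → a ≢ lookup π j
  All-≢⇒≢-lookup (b ∷ π) (h ∷ hs) fzero = h
  All-≢⇒≢-lookup (b ∷ π) (h ∷ hs) (fsuc j) = All-≢⇒≢-lookup π hs j

  Unique⇒lookup-injective : ∀ {A : Set} {n} (π : Vec A n) → Unique (toList π) → ∀ {i j} → lookup π i ≡ lookup π j → i ≡ j
  Unique⇒lookup-injective (a ∷ π) (a∉ ∷ u) {fzero} {fzero} eq = refl
  Unique⇒lookup-injective (a ∷ π) (a∉ ∷ u) {fzero} {fsuc j} eq with () ← All-≢⇒≢-lookup π a∉ j eq
  Unique⇒lookup-injective (a ∷ π) (a∉ ∷ u) {fsuc i} {fzero} eq = sym (Unique⇒lookup-injective (a ∷ π) (a∉ ∷ u) (sym eq))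
  Unique⇒lookup-injective (a ∷ π) (a∉ ∷ u) {fsuc i} {fsuc j} eq = cong fsuc (Unique⇒lookup-injective π u eq)

  Unique-resp-↭ : ∀ {A : Set} {xs ys : List A} → xs ↭ ys → Unique xs → Unique ys
  Unique-resp-↭ p u = PSP.Unique-resp-↭ (setoid _) (↭⇒↭ₛ p) u

  toList-tabulate : ∀ {A : Set} {n} (f : Fin n → A) → toList (tabulate f) ≡ Data.List.tabulate f
  toList-tabulate {n = zero} f = refl
  toList-tabulate {n = suc n} f = cong (f fzero ∷_) (toList-tabulate (λ i → f (fsuc i)))

  Unique-finList : ∀ n → Unique (finList n)
  Unique-finList n = subst Unique (sym (toList-tabulate (λ i → i))) (UP.allFin⁺ n)

  Unique-lifts : ∀ {n₁ n₂} → Unique (map (liftˡ {n₁} {n₂}) (finList n₁) ++ map (liftʳ {n₁} {n₂}) (finList n₂))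
  Unique-lifts {n₁} {n₂} = UP.++⁺ (UP.map⁺ (λ {i} {j} → FP.↑ˡ-injective n₂ i j) (Unique-finList n₁))
                                  (UP.map⁺ (λ {i} {j} → FP.↑ʳ-injective n₁ i j) (Unique-finList n₂))
                                  disjoint
    where
      disjoint : Disjoint (map (liftˡ {n₁} {n₂}) (finList n₁)) (map liftʳ (finList n₂))
      disjoint (p , q) with ∈-map⁻ liftˡ p | ∈-map⁻ liftʳ q
      ... | i , _ , refl | j , _ , i↑ˡ≡j↑ʳ = <-irrefl (cong toℕ i↑ˡ≡j↑ʳ) below
        where below : toℕ (i ↑ˡ n₂) < toℕ (n₁ ↑ʳ j)
              below rewrite FP.toℕ-↑ˡ i n₂ | FP.toℕ-↑ʳ n₁ j = <-≤-trans (FP.toℕ<n i) (m≤m+n n₁ (toℕ j))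


module ModularArithmetic (N : ℕ) .{{_ : NonZero N}} where

  open ZMod N
  open import Data.Nat using (ℕ; suc; _+_; _∸_; _≤_; _<_; _%_)
  open import Data.Nat.Properties using (+-comm; +-assoc; m+[n∸m]≡n; <⇒≤)
  open import Data.Nat.DivMod using (_mod_; m%n<n; %-distribˡ-+; m%n%n≡m%n; [m+n]%n≡m%n; m<n⇒m%n≡m)
  open import Data.Fin using (toℕ)
  import Data.Fin.Properties as FP
  open import Relation.Binary.PropositionalEquality using (_≡_; refl; sym; trans; cong)

  toℕ-mod : ∀ m → toℕ (m mod N) ≡ m % N
  toℕ-mod m = FP.toℕ-fromℕ< (m%n<n m N)

  [m%N+n]%N≡[m+n]%N : ∀ m n → ((m % N) + n) % N ≡ (m + n) % N
  [m%N+n]%N≡[m+n]%N m n = trans (%-distribˡ-+ (m % N) n N)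
    (trans (cong (λ z → (z + n % N) % N) (m%n%n≡m%n m N)) (sym (%-distribˡ-+ m n N)))

  [a+b+[N∸a]]%N≡b : ∀ a b → a ≤ N → b < N → (a + b + (N ∸ a)) % N ≡ b
  [a+b+[N∸a]]%N≡b a b a≤N b<N = trans (cong (_% N) b+N) (trans ([m+n]%n≡m%n b N) (m<n⇒m%n≡m b<N))
    where b+N : a + b + (N ∸ a) ≡ b + N
          b+N = trans (cong (_+ (N ∸ a)) (+-comm a b)) (trans (+-assoc b a (N ∸ a)) (cong (b +_) (m+[n∸m]≡n a≤N)))

  [a⊕b]⊖a≡b : ∀ (a b : ZN) → (a ⊕ b) ⊖ a ≡ b
  [a⊕b]⊖a≡b a b = FP.toℕ-injective (trans (toℕ-mod _)
    (trans (cong (λ z → (z + (N ∸ toℕ a)) % N) (toℕ-mod (toℕ a + toℕ b)))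
    (trans ([m%N+n]%N≡[m+n]%N (toℕ a + toℕ b) (N ∸ toℕ a))
           ([a+b+[N∸a]]%N≡b (toℕ a) (toℕ b) (<⇒≤ (FP.toℕ<n a)) (FP.toℕ<n b)))))

  a⊕[b⊖a]≡b : ∀ (a b : ZN) → a ⊕ (b ⊖ a) ≡ b
  a⊕[b⊖a]≡b a b = FP.toℕ-injective (trans (toℕ-mod _)
    (trans (cong (λ z → (toℕ a + z) % N) (toℕ-mod (toℕ b + (N ∸ toℕ a))))
    (trans (cong (_% N) (+-comm (toℕ a) _))
    (trans ([m%N+n]%N≡[m+n]%N (toℕ b + (N ∸ toℕ a)) (toℕ a))
    (trans (cong (_% N) (trans (+-comm _ (toℕ a)) (sym (+-assoc (toℕ a) (toℕ b) _))))
           ([a+b+[N∸a]]%N≡b (toℕ a) (toℕ b) (<⇒≤ (FP.toℕ<n a)) (FP.toℕ<n b)))))))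

  0ₙ⊕a≡a : ∀ (a : ZN) → 0ₙ ⊕ a ≡ a
  0ₙ⊕a≡a a = FP.toℕ-injective (trans (toℕ-mod _)
    (trans (cong (λ z → (z + toℕ a) % N) (trans (toℕ-mod 0) (0%N≡0 N))) (m<n⇒m%n≡m (FP.toℕ<n a))))
    where 0%N≡0 : ∀ n .{{_ : NonZero n}} → 0 % n ≡ 0
          0%N≡0 (suc n) = refl


module Triangular {c ℓ : Level} (K : CommutativeRing c ℓ) (N : ℕ) .{{_ : NonZero N}} where

  open ZMod N
  open Series K
  open CommutativeRing K
  open RingSums K
  open Expansion N
  open ListProperties using (filter-map-comm)
  open LeadingWord N
  open ListProperties using (map-proj₂-toList-zip)
  open Relabelling N using (Unique-finList)
  open SumOver using (sumOver; sumOver-finList)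
  open import Data.Nat using (ℕ; zero; suc; _≤_; _<_; _≟_)
  open import Data.Nat.Properties using (<-≤-trans; ≤∧≢⇒<; ≤-pred)
  open import Data.Fin using () renaming (zero to fzero; suc to fsuc)
  open import Data.Product using (_×_; _,_; proj₂; Σ)
  open import Data.List using (List; []; _∷_; _++_; map; filter; length; replicate)
  import Data.List.Properties as LP
  open import Data.List.Membership.Propositional using (_∈_)
  open import Data.List.Membership.Propositional.Properties using (∈-filter⁻)
  open import Data.List.Relation.Unary.All as All using (All; []; _∷_)
  import Data.List.Relation.Unary.All.Properties as AllP
  open import Data.List.Relation.Unary.Any using (here)
  open import Data.List.Relation.Unary.Unique.Propositional using (Unique; _∷_)
  open import Data.Vec using (Vec; _∷_; toList; lookup; zip; allFin; fromList; tabulate)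
  import Data.Vec.Properties as VP
  open import Relation.Binary.PropositionalEquality as ≡ using (_≡_; _≢_; cong; subst)
  open import Relation.Nullary.Decidable using (¬?)
  open import Relation.Binary.Reasoning.Setoid setoid

  toList⁻¹ : ∀ {n} (ms : List ℕ) → length ms ≡ n → Σ (Vec ℕ n) (λ v → toList v ≡ ms)
  toList⁻¹ ms ≡.refl = fromList ms , VP.toList∘fromList ms

  length-lettersOf : ∀ {n} (a : Vec ZN n) → length (lettersOf a) ≡ n
  length-lettersOf {n} a = VP.length-toList (zip a (allFin n))

  canonicalWord-lettersOf : ∀ {n} (a : Vec ZN n) (m : Vec ℕ n) → canonicalWord (lettersOf a) m ≡ wordOf (lettersOf a) (toList m)
  canonicalWord-lettersOf {n} a m = cong (wordOf (lettersOf a)) (≡.trans (LP.map-∘ (lettersOf a))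
    (≡.trans (cong (map (lookup m)) (map-proj₂-toList-zip a (allFin n)))
    (≡.trans (≡.sym (VP.toList-map (lookup m) (allFin n))) (cong toList (VP.map-lookup-allFin m)))))

  module _ {r : ℕ} (a₀ : ZN) (a' : Vec ZN r) where
    private
      a = a₀ ∷ a'
      pending : Letters (suc r)
      pending = toList (zip a' (tabulate fsuc))

      fresh-labels : Unique (fzero ∷ map proj₂ pending)
      fresh-labels = subst Unique (≡.sym (map-proj₂-toList-zip a (allFin (suc r)))) (Unique-finList (suc r))

      canonical : ∀ m → Canonical [] fzero pending (degree m) m (lookup m fzero)
      canonical m with fresh-labels
      ... | zero-fresh ∷ unique = record
        { cur-exponent = ≡.refl
        ; used-up = []
        ; cur-fresh = λ z∈ → All.lookup zero-fresh z∈ ≡.refl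
        ; pending-unique = unique
        ; degree-exact = ≡.trans (≡.sym (sumOver-finList m)) (cong (λ S → sumOver S m) (≡.sym (map-proj₂-toList-zip a (allFin (suc r)))))
        }

    expansion-lettersOf : ∀ D e → expansion [] (lettersOf a) D e ≡ map (y a₀ ∷_) (expansion (fzero ∷ []) pending D e)
    expansion-lettersOf zero e = LP.++-identityʳ _
    expansion-lettersOf (suc D) e = LP.++-identityʳ _

    expansion-words : ∀ D e →
      All (λ u → Σ (Vec ℕ (suc r)) λ m → u ≡ wordOf (lettersOf a) (toList m)) (expansion [] (lettersOf a) D e)
    expansion-words D e = subst (All _) (≡.sym (expansion-lettersOf D e))
      (AllP.map⁺ (All.map (λ { (j , ms , len , eq) → asWord j ms len eq }) (expansion-shape (fzero ∷ []) pending D e)))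
      where
        asWord : ∀ j ms → length ms ≡ length pending → ∀ {u} → u ≡ replicate j x ++ wordOf pending ms →
                 Σ (Vec ℕ (suc r)) λ m → y a₀ ∷ u ≡ wordOf (lettersOf a) (toList m)
        asWord j ms len eq with toList⁻¹ (j ∷ ms) (≡.trans (cong suc len) (length-lettersOf a))
        ... | m , toList-m = m , ≡.trans (cong (y a₀ ∷_) eq) (cong (wordOf (lettersOf a)) (≡.sym toList-m))

    leadingInversions : Vec ℕ (suc r) → ℕ
    leadingInversions m = maxInversions pending m (lookup m fzero)

    expansion-leadingWord : ∀ m →
      filter (λ u → inversions u ≟ leadingInversions m) (expansion [] (lettersOf a) (degree m) m) ≡ wordOf (lettersOf a) (toList m) ∷ []
    expansion-leadingWord m =
      ≡.trans (cong (filter P?) (expansion-lettersOf (degree m) m))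
      (≡.trans (filter-map-comm P? P? (y a₀ ∷_) (All.universal (λ _ → ≡.refl) (expansion (fzero ∷ []) pending (degree m) m)))
      (≡.trans (cong (map (y a₀ ∷_)) (expansion-maxInversions [] fzero pending (degree m) m (lookup m fzero) (canonical m)))
               (cong (_∷ []) (canonicalWord-lettersOf a m))))
      where P? = λ u → inversions u ≟ leadingInversions m

    -- If H sums to zero over every expansion, it vanishes on every word: the word of m is the unique
    -- word of its own expansion with the most inversions, and all other words of that expansion are
    -- words of other exponent vectors with fewer inversions.
    vanishes-by-triangularity : (H : LWord → Carrier) → (∀ e → ΣL (map H (expansion [] (lettersOf a) (degree e) e)) ≈ 0#) →
      ∀ B (m : Vec ℕ (suc r)) → inversions (wordOf (lettersOf a) (toList m)) < B → H (wordOf (lettersOf a) (toList m)) ≈ 0#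
    vanishes-by-triangularity H hyp (suc B) m inversions< = begin
        H w
          ≈⟨ sym (+-identityʳ _) ⟩
        ΣL (map H (w ∷ []))
          ≡⟨ cong (λ ws → ΣL (map H ws)) (≡.sym leading) ⟩
        ΣL (map H (filter P? L))
          ≈⟨ sym (+-identityʳ _) ⟩
        ΣL (map H (filter P? L)) + 0#
          ≈⟨ +-congˡ (sym (ΣL-zero-All (All.map others-vanish
               (All.zip (AllP.filter⁺ _ (All.zip (expansion-inversions≤ [] (lettersOf a) (degree m) m , expansion-words (degree m) m)) ,
                         AllP.all-filter (λ u → ¬? (P? u)) L))))) ⟩
        ΣL (map H (filter P? L)) + ΣL (map H (filter (λ u → ¬? (P? u)) L))
          ≈⟨ sym (ΣL-partition P? H L) ⟩
        ΣL (map H L)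
          ≈⟨ hyp m ⟩
        0# ∎
      where
        w = wordOf (lettersOf a) (toList m)
        L = expansion [] (lettersOf a) (degree m) m
        P? = λ u → inversions u ≟ leadingInversions m
        leading = expansion-leadingWord m
        inversions-w : inversions w ≡ leadingInversions m
        inversions-w = proj₂ (∈-filter⁻ P? {xs = L} (subst (w ∈_) (≡.sym leading) (here ≡.refl)))
        others-vanish : ∀ {u} → ((inversions u ≤ leadingInversions m) × (Σ (Vec ℕ (suc r)) λ m' → u ≡ wordOf (lettersOf a) (toList m')))
                                × (inversions u ≢ leadingInversions m) → H u ≈ 0#
        others-vanish ((below , m' , ≡.refl) , not-max) =
          vanishes-by-triangularity H hyp B m' (<-≤-trans (≤∧≢⇒< below not-max) (≤-pred (subst (_< suc B) inversions-w inversions<)))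
    vanishes-by-triangularity H hyp zero m ()


module WordEncoding (N : ℕ) .{{_ : NonZero N}} where

  open ZMod N
  open ModularArithmetic N
  open Expansion N using (wordOf; lettersOf)
  open ListProperties using (zip-map-proj)
  open import Data.Nat using (ℕ; zero; suc; _+_)
  open import Data.Nat.Properties using (+-identityʳ; +-suc)
  open import Data.Fin using (Fin)
  open import Data.Product using (_,_; proj₁; proj₂)
  open import Data.Maybe using (just)
  open import Data.List using ([]; _∷_; _++_; replicate)
  open import Data.Vec as V using (Vec; []; _∷_; toList; zip; allFin)
  open import Relation.Binary.PropositionalEquality using (_≡_; refl; sym; trans; cong; cong₂)

  ρinvAcc-zip : ∀ {k} acc (m : Vec ℕ k) (a : Vec ZN k) → ρinvAcc acc (toList (zip m a)) ≡ toList (zip m (psumsAcc acc a))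
  ρinvAcc-zip acc [] [] = refl
  ρinvAcc-zip acc (k ∷ m) (b ∷ a) = cong ((k , acc ⊕ b) ∷_) (ρinvAcc-zip (acc ⊕ b) m a)

  ρdiff-ρinvAcc : ∀ acc w → ρdiff acc (ρinvAcc acc w) ≡ w
  ρdiff-ρinvAcc acc [] = refl
  ρdiff-ρinvAcc acc ((k , b) ∷ w) = cong₂ _∷_ (cong (k ,_) ([a⊕b]⊖a≡b acc b)) (ρdiff-ρinvAcc (acc ⊕ b) w)

  ρ-ρ⁻¹ : ∀ w → ρ (ρ⁻¹ w) ≡ w
  ρ-ρ⁻¹ [] = refl
  ρ-ρ⁻¹ ((k , b) ∷ w) =
    trans (cong (λ b' → (k , b') ∷ ρdiff b' (ρinvAcc b' w)) (0ₙ⊕a≡a b)) (cong ((k , b) ∷_) (ρdiff-ρinvAcc b w))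

  parseFrom-toLetters : ∀ a j k w → parseFrom a j (replicate k x ++ toLetters w) ≡ (k + j , a) ∷ w
  parseFrom-toLetters a j zero [] = refl
  parseFrom-toLetters a j zero ((k' , b) ∷ w) =
    cong ((j , a) ∷_) (trans (parseFrom-toLetters b 0 k' w) (cong (λ i → (i , b) ∷ w) (+-identityʳ k')))
  parseFrom-toLetters a j (suc k) w =
    trans (parseFrom-toLetters a (suc j) k w) (cong (λ i → (i , a) ∷ w) (+-suc k j))

  parse-toLetters : ∀ k a w → parse (toLetters ((k , a) ∷ w)) ≡ just ((k , a) ∷ w)
  parse-toLetters k a w = cong just (trans (parseFrom-toLetters a 0 k w) (cong (λ i → (i , a) ∷ w) (+-identityʳ k)))

  toLetters-wordOf : ∀ {k n} (m : Vec ℕ k) (a : Vec ZN k) (v : Vec (Fin n) k) →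
    toLetters (toList (zip m a)) ≡ wordOf (toList (zip a v)) (toList m)
  toLetters-wordOf [] [] [] = refl
  toLetters-wordOf (k ∷ m) (b ∷ a) (l ∷ v) = cong (λ w → y b ∷ (replicate k x ++ w)) (toLetters-wordOf m a v)

  toLetters-ρ-psums : ∀ {k} (m : Vec ℕ k) (a : Vec ZN k) → toLetters (ρ (toList (zip m (psums a)))) ≡ wordOf (lettersOf a) (toList m)
  toLetters-ρ-psums {k} m a = trans (cong (λ w → toLetters (ρ w)) (sym (ρinvAcc-zip 0ₙ m a)))
                                    (trans (cong toLetters (ρ-ρ⁻¹ (toList (zip m a)))) (toLetters-wordOf m a (allFin k)))

  differences : ∀ {k} → ZN → Vec ZN k → Vec ZN k
  differences acc [] = []
  differences acc (b ∷ v) = (b ⊖ acc) ∷ differences b v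

  psumsAcc-differences : ∀ {k} acc (w : Vec ZN k) → psumsAcc acc (differences acc w) ≡ w
  psumsAcc-differences acc [] = refl
  psumsAcc-differences acc (b ∷ w) rewrite a⊕[b⊖a]≡b acc b = cong (b ∷_) (psumsAcc-differences b w)

  zip-psums-differences : ∀ {k} (w : Vec Z k) → zip (V.map proj₁ w) (psums (differences 0ₙ (V.map proj₂ w))) ≡ w
  zip-psums-differences w = trans (cong (zip (V.map proj₁ w)) (psumsAcc-differences 0ₙ (V.map proj₂ w))) (zip-map-proj w)


module Equivalence {c ℓ : Level} (K : CommutativeRing c ℓ) (N : ℕ) .{{_ : NonZero N}} (f : ZMod.Word N → CommutativeRing.Carrier K) where

  open ZMod N
  open Series K
  open Series.WithN K N
  open CommutativeRing K
  open RingSums K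
  open ListProperties using (map-proj₂-toList-zip; zip-map-proj; take-++; drop-++)
  open SumOver
  open Expansion N
  open ShuffleOfExpansions N
  open LeadingWord N using (inversions)
  open CoefficientExpansion K N using (Σcoeff≈Σexpansion)
  open Relabelling N
  open Triangular K N
  open WordEncoding N
  import Algebra.Properties.AbelianGroup +-abelianGroup as +-AbelianGroup
  open import Data.Nat using (ℕ; suc) renaming (_+_ to _+ℕ_)
  open import Data.Nat.Properties using (n<1+n; ≤-reflexive)
  open import Data.Fin using (Fin; _↑ˡ_; _↑ʳ_)
  open import Data.Product using (_×_; _,_; proj₁; proj₂; Σ; map₂)
  open import Data.Maybe using (just; nothing; maybe′)
  open import Data.List using ([]; _∷_; _++_; map; concatMap; mapMaybe; length)
  import Data.List.Properties as LP
  open import Data.List.Relation.Binary.Permutation.Propositional using (_↭_; ↭-sym)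
  import Data.List.Relation.Binary.Permutation.Propositional.Properties as PP
  open import Data.List.Relation.Unary.All as All using (All)
  import Data.List.Relation.Unary.All.Properties as AllP
  open import Data.Vec as V using (Vec; []; _∷_; toList; lookup; zip; allFin; take; drop) renaming (_++_ to _++ᵛ_)
  import Data.Vec.Properties as VP
  open import Relation.Binary.PropositionalEquality as ≡ using (_≡_; cong; cong₂)
  open import Relation.Binary.Reasoning.Setoid setoid

  -- f on the words of 𝔥 in the letters x, y_a: through ρ⁻¹ on the words of 𝔥¹, and 0 on the others.
  G : LWord → Carrier
  G t = maybe′ (λ w → f (ρ⁻¹ w)) 0# (parse t)

  fLin-parse : ∀ ts → ΣL (map f (map ρ⁻¹ (mapMaybe parse ts))) ≈ ΣL (map G ts)
  fLin-parse [] = refl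
  fLin-parse (t ∷ ts) with parse t
  ... | just w = +-congˡ (fLin-parse ts)
  ... | nothing = trans (fLin-parse ts) (sym (+-identityˡ _))

  f≡G-wordOf : ∀ {r} (m : Vec ℕ (suc r)) (a : Vec ZN (suc r)) → f (toList (zip m (psums a))) ≡ G (wordOf (lettersOf a) (toList m))
  f≡G-wordOf {r} (k ∷ m) (b ∷ a) =
    ≡.trans (cong f (≡.sym (ρinvAcc-zip 0ₙ (k ∷ m) (b ∷ a))))
    (≡.trans (cong (maybe′ (λ w → f (ρ⁻¹ w)) 0#) (≡.sym (parse-toLetters k b (toList (zip m a)))))
             (cong G (toLetters-wordOf (k ∷ m) (b ∷ a) (allFin (suc r)))))

  F#≈expansion : ∀ {r} (a : Vec ZN (suc r)) e → F# f a e ≈ ΣL (map G (expansion [] (lettersOf a) (degree e) e))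
  F#≈expansion {r} a e =
    trans (ΣL-cong (comps (suc r) (degree e)) (λ m → reflexive (cong (coeffᴾ (yMonomial m) e ·ℕ_) (f≡G-wordOf m a))))
          (Σcoeff≈Σexpansion a e G)

  fLin-ш~≈shuffle : ∀ {r s} (m : Vec ℕ (suc r)) (a : Vec ZN (suc r)) (n : Vec ℕ (suc s)) (b : Vec ZN (suc s)) →
    fLin f (toList (zip m (psums a)) ш~ toList (zip n (psums b)))
      ≈ ΣL (map G (wordOf (lettersOf a) (toList m) ш wordOf (lettersOf b) (toList n)))
  fLin-ш~≈shuffle m a n b =
    trans (fLin-parse (toLetters (ρ (toList (zip m (psums a)))) ш toLetters (ρ (toList (zip n (psums b))))))
          (reflexive (cong (λ ts → ΣL (map G ts)) (cong₂ _ш_ (toLetters-ρ-psums m a) (toLetters-ρ-psums n b))))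

  module _ {r s : ℕ} (a : Vec ZN (suc r)) (b : Vec ZN (suc s)) (e₁ : Vec ℕ (suc r)) (e₂ : Vec ℕ (suc s)) where
    expansionˡ = expansion [] (lettersOf a) (degree e₁) e₁
    expansionʳ = expansion [] (lettersOf b) (degree e₂) e₂

    product≈expansionPairs : F# f a e₁ * F# f b e₂ ≈ ΣL (map (λ u → ΣL (map (λ v → G u * G v) expansionʳ)) expansionˡ)
    product≈expansionPairs =
      trans (*-cong (F#≈expansion a e₁) (F#≈expansion b e₂))
            (trans (ΣL-*ʳ _ G expansionˡ) (ΣL-cong expansionˡ (λ u → ΣL-*ˡ (G u) G expansionʳ)))

    private
      n₁ = suc r
      n₂ = suc s
      E = e₁ ++ᵛ e₂
      D = degree e₁ +ℕ degree e₂
      left : Vec (ZN × Fin (n₁ +ℕ n₂)) n₁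
      left = zip a (V.map (_↑ˡ n₂) (allFin n₁))
      right : Vec (ZN × Fin (n₁ +ℕ n₂)) n₂
      right = zip b (V.map (n₁ ↑ʳ_) (allFin n₂))

      map-relabel-zip : ∀ {k n n'} (α : Vec ZN k) (v : Vec (Fin n) k) (g : Fin n → Fin n') →
                        map (map₂ g) (toList (zip α v)) ≡ toList (zip α (V.map g v))
      map-relabel-zip [] [] g = ≡.refl
      map-relabel-zip (p ∷ α) (l ∷ v) g = cong (_ ∷_) (map-relabel-zip α v g)

      labels-left : map proj₂ (toList left) ≡ map (liftˡ {n₁} {n₂}) (finList n₁)
      labels-left = ≡.trans (map-proj₂-toList-zip a (V.map (_↑ˡ n₂) (allFin n₁))) (VP.toList-map (_↑ˡ n₂) (allFin n₁))
      labels-right : map proj₂ (toList right) ≡ map (liftʳ {n₁} {n₂}) (finList n₂)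
      labels-right = ≡.trans (map-proj₂-toList-zip b (V.map (n₁ ↑ʳ_) (allFin n₂))) (VP.toList-map (n₁ ↑ʳ_) (allFin n₂))

    -- The term of an interleaving w is F# of its ZN-letters evaluated at E with the variables permuted
    -- as in w; relabelling the variables back turns its expansion into that of the letter sequence w.
    permVars-F#≈expansion : ∀ w → toList w ↭ toList left ++ toList right →
      permVars (F# f (V.map proj₁ w)) (V.map proj₂ w) E ≈ ΣL (map G (expansion [] (toList w) D E))
    permVars-F#≈expansion w w↭ = trans (F#≈expansion α (V.map (lookup E) π))
      (reflexive (cong (λ ws → ΣL (map G ws))
        (≡.trans (expansion-relabel π π-injective [] (lettersOf α) (degree (V.map (lookup E) π)) E)
                 (cong₂ (λ c d → expansion [] c d E) relabelled-letters degree-E))))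
      where
        α = V.map proj₁ w
        π = V.map proj₂ w
        labels-↭ : toList π ↭ map (liftˡ {n₁} {n₂}) (finList n₁) ++ map (liftʳ {n₁} {n₂}) (finList n₂)
        labels-↭ = ≡.subst₂ _↭_ (≡.sym (VP.toList-map proj₂ w))
                     (≡.trans (LP.map-++ proj₂ (toList left) (toList right)) (cong₂ _++_ labels-left labels-right))
                     (PP.map⁺ proj₂ w↭)
        π-injective : ∀ {i j} → lookup π i ≡ lookup π j → i ≡ j
        π-injective = Unique⇒lookup-injective π (Unique-resp-↭ (↭-sym labels-↭) (Unique-lifts {n₁} {n₂}))
        degree-E : degree (V.map (lookup E) π) ≡ D
        degree-E = ≡.trans (degree-map-lookup E π) (≡.trans (sumOver-↭ E labels-↭)
          (≡.trans (sumOver-++ (map (liftˡ {n₁} {n₂}) (finList n₁)) (map (liftʳ {n₁} {n₂}) (finList n₂)) E)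
                   (cong₂ _+ℕ_ (≡.trans (sumOver-map (_↑ˡ n₂) (finList n₁) e₁ E (VP.lookup-++ˡ e₁ e₂)) (sumOver-finList e₁))
                               (≡.trans (sumOver-map (n₁ ↑ʳ_) (finList n₂) e₂ E (VP.lookup-++ʳ e₁ e₂)) (sumOver-finList e₂)))))
        relabelled-letters : map (relabelLetter π π-injective) (lettersOf α) ≡ toList w
        relabelled-letters = ≡.trans (map-relabel-zip α (allFin _) (lookup π))
                               (cong toList (≡.trans (cong (zip α) (VP.map-lookup-allFin π)) (zip-map-proj w)))

    interleavings≈shuffles :
      ΣL (map (λ w → permVars (F# f (V.map proj₁ w)) (V.map proj₂ w) E) (interleave left right))
        ≈ ΣL (map (λ u → ΣL (map (λ v → ΣL (map G (u ш v))) expansionʳ)) expansionˡ)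
    interleavings≈shuffles = begin
      ΣL (map (λ w → permVars (F# f (V.map proj₁ w)) (V.map proj₂ w) E) (interleave left right))
        ≈⟨ ΣL-cong-All (All.map (λ {w} → permVars-F#≈expansion w) interleave-↭) ⟩
      ΣL (map (λ w → expandedSum (toList w)) (interleave left right))
        ≡⟨ ≡.sym (ΣL-map expandedSum toList (interleave left right)) ⟩
      ΣL (map expandedSum (map toList (interleave left right)))
        ≡⟨ cong (λ ws → ΣL (map expandedSum ws))
                (≡.trans (map-toList-interleave left right) (cong₂ interleavings (lifted a (allFin n₁) (_↑ˡ n₂)) (lifted b (allFin n₂) (n₁ ↑ʳ_)))) ⟩
      ΣL (map expandedSum (interleavings (map (liftLetterˡ {n₁} {n₂}) (lettersOf a)) (map (liftLetterʳ {n₁} {n₂}) (lettersOf b))))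
        ≈⟨ sym (ΣL-concatMap G (λ c → expansion [] c D E) (interleavings (map (liftLetterˡ {n₁} {n₂}) (lettersOf a)) (map (liftLetterʳ {n₁} {n₂}) (lettersOf b)))) ⟩
      ΣL (map G (interleavedExpansion [] (lettersOf a) (degree e₁) e₁ [] (lettersOf b) (degree e₂) e₂))
        ≈⟨ ΣL-↭ G (↭-sym (shuffle-expansion-↭ (suc size) [] (lettersOf a) (degree e₁) e₁ [] (lettersOf b) (degree e₂) e₂
                             (n<1+n size) (budget a e₁) (budget b e₂))) ⟩
      ΣL (map G (shuffleAll expansionˡ expansionʳ))
        ≈⟨ ΣL-concatMap G (λ u → concatMap (λ v → u ш v) expansionʳ) expansionˡ ⟩
      ΣL (map (λ u → ΣL (map G (concatMap (λ v → u ш v) expansionʳ))) expansionˡ)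
        ≈⟨ ΣL-cong expansionˡ (λ u → ΣL-concatMap G (λ v → u ш v) expansionʳ) ⟩
      ΣL (map (λ u → ΣL (map (λ v → ΣL (map G (u ш v))) expansionʳ)) expansionˡ) ∎
      where
        expandedSum : Letters (n₁ +ℕ n₂) → Carrier
        expandedSum c = ΣL (map G (expansion [] c D E))
        size = length (lettersOf a) +ℕ length (lettersOf b) +ℕ D
        interleave-↭ : All (λ w → toList w ↭ toList left ++ toList right) (interleave left right)
        interleave-↭ = AllP.map⁻ (≡.subst (All _) (≡.sym (map-toList-interleave left right)) (interleavings-↭ (toList left) (toList right)))
        lifted : ∀ {k n} (α : Vec ZN k) (v : Vec (Fin n) k) (g : Fin n → Fin (n₁ +ℕ n₂)) →
                 toList (zip α (V.map g v)) ≡ map (map₂ g) (toList (zip α v))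
        lifted α v g = ≡.sym (map-relabel-zip α v g)
        budget : ∀ {k} (α : Vec ZN k) (e : Vec ℕ k) → Budget [] (lettersOf α) (degree e) e
        budget {k} α e = ≤-reflexive (≡.trans (cong (λ S → sumOver S e) (map-proj₂-toList-zip α (allFin k))) (sumOver-finList e))

  condI⇒condII : CondI f → CondII f
  condI⇒condII cI r s (a₀ ∷ a') (b₀ ∷ b') e = begin
      F# f a (take (suc r) e) * F# f b (drop (suc r) e)
        ≈⟨ product≈expansionPairs a b e₁ e₂ ⟩
      ΣL (map (λ u → ΣL (map (λ v → G u * G v) (expansionʳ a b e₁ e₂))) (expansionˡ a b e₁ e₂))
        ≈⟨ ΣL-cong-All (All.map pairs (expansion-words a₀ a' (degree e₁) e₁)) ⟩
      ΣL (map (λ u → ΣL (map (λ v → ΣL (map G (u ш v))) (expansionʳ a b e₁ e₂))) (expansionˡ a b e₁ e₂))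
        ≈⟨ sym (interleavings≈shuffles a b e₁ e₂) ⟩
      ΣL (map (λ w → permVars (F# f (V.map proj₁ w)) (V.map proj₂ w) (e₁ ++ᵛ e₂)) interleavings′)
        ≡⟨ cong (λ e' → ΣL (map (λ w → permVars (F# f (V.map proj₁ w)) (V.map proj₂ w) e') interleavings′))
                (VP.take++drop≡id (suc r) e) ⟩
      ΣL (map (λ w → permVars (F# f (V.map proj₁ w)) (V.map proj₂ w) e) interleavings′) ∎
    where
      a = a₀ ∷ a'
      b = b₀ ∷ b'
      e₁ = take (suc r) e
      e₂ = drop (suc r) e
      interleavings′ = interleave (zip a (V.map (_↑ˡ suc s) (allFin (suc r)))) (zip b (V.map (suc r ↑ʳ_) (allFin (suc s))))
      shuffle : ∀ m {v} → (Σ (Vec ℕ (suc s)) λ n → v ≡ wordOf (lettersOf b) (toList n)) →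
                G (wordOf (lettersOf a) (toList m)) * G v ≈ ΣL (map G (wordOf (lettersOf a) (toList m) ш v))
      shuffle m (n , ≡.refl) = trans (reflexive (cong₂ _*_ (≡.sym (f≡G-wordOf m a)) (≡.sym (f≡G-wordOf n b))))
                                     (trans (cI r s (zip m (psums a)) (zip n (psums b))) (fLin-ш~≈shuffle m a n b))
      pairs : ∀ {u} → (Σ (Vec ℕ (suc r)) λ m → u ≡ wordOf (lettersOf a) (toList m)) →
              ΣL (map (λ v → G u * G v) (expansionʳ a b e₁ e₂)) ≈ ΣL (map (λ v → ΣL (map G (u ш v))) (expansionʳ a b e₁ e₂))
      pairs (m , ≡.refl) = ΣL-cong-All (All.map (shuffle m) (expansion-words b₀ b' (degree e₂) e₂))

  module _ (cII : CondII f) {r s : ℕ} (a₀ : ZN) (a' : Vec ZN r) (b₀ : ZN) (b' : Vec ZN s) where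
    private
      a = a₀ ∷ a'
      b = b₀ ∷ b'
      defect : LWord → LWord → Carrier
      defect u v = G u * G v - ΣL (map G (u ш v))

      pairs-balance : ∀ e₁ e₂ → ΣL (map (λ u → ΣL (map (λ v → G u * G v) (expansionʳ a b e₁ e₂))) (expansionˡ a b e₁ e₂))
                              ≈ ΣL (map (λ u → ΣL (map (λ v → ΣL (map G (u ш v))) (expansionʳ a b e₁ e₂))) (expansionˡ a b e₁ e₂))
      pairs-balance e₁ e₂ = begin
        _ ≈⟨ sym (product≈expansionPairs a b e₁ e₂) ⟩
        F# f a e₁ * F# f b e₂
          ≡⟨ cong₂ (λ e e' → F# f a e * F# f b e') (≡.sym (take-++ e₁ e₂)) (≡.sym (drop-++ e₁ e₂)) ⟩
        F# f a (take (suc r) (e₁ ++ᵛ e₂)) * F# f b (drop (suc r) (e₁ ++ᵛ e₂))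
          ≈⟨ cII r s a b (e₁ ++ᵛ e₂) ⟩
        _ ≈⟨ interleavings≈shuffles a b e₁ e₂ ⟩
        _ ∎

      defect-pairs : ∀ e₁ e₂ → ΣL (map (λ u → ΣL (map (defect u) (expansionʳ a b e₁ e₂))) (expansionˡ a b e₁ e₂)) ≈ 0#
      defect-pairs e₁ e₂ =
        trans (ΣL-cong (expansionˡ a b e₁ e₂) (λ u → ΣL-- (λ v → G u * G v) (λ v → ΣL (map G (u ш v))) (expansionʳ a b e₁ e₂)))
        (trans (ΣL-- _ _ (expansionˡ a b e₁ e₂)) (+-AbelianGroup.x≈y⇒x∙y⁻¹≈ε (pairs-balance e₁ e₂)))

      defect-left : ∀ (m : Vec ℕ (suc r)) e₂ → ΣL (map (defect (wordOf (lettersOf a) (toList m))) (expansion [] (lettersOf b) (degree e₂) e₂)) ≈ 0#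
      defect-left m e₂ = vanishes-by-triangularity a₀ a' (λ u → ΣL (map (defect u) (expansion [] (lettersOf b) (degree e₂) e₂)))
                           (λ e₁ → defect-pairs e₁ e₂) (suc (inversions (wordOf (lettersOf a) (toList m)))) m (n<1+n _)

    shuffleRelation : ∀ (m : Vec ℕ (suc r)) (n : Vec ℕ (suc s)) →
      G (wordOf (lettersOf a) (toList m)) * G (wordOf (lettersOf b) (toList n))
        ≈ ΣL (map G (wordOf (lettersOf a) (toList m) ш wordOf (lettersOf b) (toList n)))
    shuffleRelation m n = +-AbelianGroup.x∙y⁻¹≈ε⇒x≈y _ _
      (vanishes-by-triangularity b₀ b' (defect (wordOf (lettersOf a) (toList m))) (defect-left m)
                                 (suc (inversions (wordOf (lettersOf b) (toList n)))) n (n<1+n _))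

  condII⇒condI : CondII f → CondI f
  condII⇒condI cII r s (u₀ ∷ u') (v₀ ∷ v') = begin
      f (toList u) * f (toList v)
        ≡⟨ cong₂ (λ u″ v″ → f (toList u″) * f (toList v″)) (≡.sym (zip-psums-differences u)) (≡.sym (zip-psums-differences v)) ⟩
      f (toList (zip (exponents u) (psums (letters u)))) * f (toList (zip (exponents v) (psums (letters v))))
        ≡⟨ cong₂ _*_ (f≡G-wordOf (exponents u) (letters u)) (f≡G-wordOf (exponents v) (letters v)) ⟩
      G (wordOf (lettersOf (letters u)) (toList (exponents u))) * G (wordOf (lettersOf (letters v)) (toList (exponents v)))
        ≈⟨ shuffleRelation cII _ _ _ _ (exponents u) (exponents v) ⟩
      ΣL (map G (wordOf (lettersOf (letters u)) (toList (exponents u)) ш wordOf (lettersOf (letters v)) (toList (exponents v))))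
        ≈⟨ sym (fLin-ш~≈shuffle (exponents u) (letters u) (exponents v) (letters v)) ⟩
      fLin f (toList (zip (exponents u) (psums (letters u))) ш~ toList (zip (exponents v) (psums (letters v))))
        ≡⟨ cong₂ (λ u″ v″ → fLin f (toList u″ ш~ toList v″)) (zip-psums-differences u) (zip-psums-differences v) ⟩
      fLin f (toList u ш~ toList v) ∎
    where
      u = u₀ ∷ u'
      v = v₀ ∷ v'
      exponents : ∀ {k} → Vec Z k → Vec ℕ k
      exponents w = V.map proj₁ w
      letters : ∀ {k} → Vec Z k → Vec ZN k
      letters w = differences 0ₙ (V.map proj₂ w)


lemma5p6 : ∀ {c ℓ} (K : CommutativeRing c ℓ) (N : ℕ) .{{_ : NonZero N}}
    (f : ZMod.Word N → CommutativeRing.Carrier K) →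
    Series.WithN.CondI K N f ⇔ Series.WithN.CondII K N f
lemma5p6 K N f = mk⇔ (Equivalence.condI⇒condII K N f) (Equivalence.condII⇒condI K N f)
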